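{- Let $\pi\in\mathbb S_r$ have cycle type $\lambda$, acting on $X=\{1,\dots,r\}$, and let $\mathcal C$ be the set of orbits of $\langle\pi^2\rangle$ acting on $X\times X$ by $(x,y)\mapsto(x\pi^2,y\pi^2)$. Then $\mathcal C$ consists of exactly $\eta(\lambda)$ orbits $\Gamma$ with $\Gamma\pi\tau=\Gamma$, together with exactly $\zeta(\lambda)$ unordered pairs $\{\Gamma,\Gamma\pi\tau\}$ with $\Gamma\pi\tau\ne\Gamma$, where $$\zeta(\lambda)=\tfrac12\sum_{i=1}^{s}\big((1+e_i)(\lambda_i+1)-2(f_i+1)\big)+\sum_{1\le i<j\le s}(1+e_{ij})\gcd(\lambda_i,\lambda_j),\qquad \eta(\lambda)=\sum_{i=1}^{s}(1-e_i+2f_i).$$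
   Context: $\tau:X\times X\to X\times X$ is $(x,y)\tau=(y,x)$ and $\Gamma\pi\tau=\{(y\pi,x\pi):(x,y)\in\Gamma\}$. The cycle lengths of $\pi$, listed with repetition, are $\lambda_1,\dots,\lambda_s$. $e_i=1$ if $\lambda_i$ is even, else $0$; $f_i=1$ if $\lambda_i\equiv2\pmod4$, else $0$; $e_{ij}=1$ if at least one of $\lambda_i,\lambda_j$ is even, else $0$. -}

module Defs where

open import Data.Nat using (ℕ; zero; suc; _+_; _*_; _∸_; _<_; _%_; _/_; _≡ᵇ_; _<ᵇ_)
open import Data.Nat.GCD using (gcd)
open import Data.Bool using (Bool; true; false; if_then_else_; _∨_)
open import Data.Fin using (Fin; toℕ)
open import Data.Fin.Permutation using (Permutation′; _⟨$⟩ʳ_)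
open import Data.List using (List; map; allFin)
open import Data.Nat.ListAction using (sum)
open import Data.Product using (Σ; ∃; _×_; _,_)
open import Data.Sum using (_⊎_)
open import Relation.Nullary using (¬_)
open import Relation.Binary.PropositionalEquality using (_≡_; _≢_)

iter : {A : Set} → (A → A) → ℕ → A → A
iter f zero x = x
iter f (suc k) x = f (iter f k x)

sumFin : (n : ℕ) → (Fin n → ℕ) → ℕ
sumFin n f = sum (map f (allFin n))

-- "the equivalence relation R restricted to the (R-invariant) predicate P
-- has exactly n classes": there are n representatives, satisfying P,
-- pairwise non-equivalent, such that every element satisfying P is
-- equivalent to one of them.
NumClasses : {A : Set} → (A → A → Set) → (A → Set) → ℕ → Set
NumClasses {A} R P n =
  Σ (Fin n → A) λ rep →
    (∀ i → P (rep i)) ×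
    (∀ i j → R (rep i) (rep j) → i ≡ j) ×
    (∀ a → P a → ∃ λ i → R (rep i) a)

module _ {r : ℕ} (π : Permutation′ r) where

  act : Fin r → Fin r
  act x = π ⟨$⟩ʳ x

  SameCycle : Fin r → Fin r → Set
  SameCycle x y = ∃ λ k → iter act k x ≡ y

  IsCycleLength : Fin r → ℕ → Set
  IsCycleLength x l =
    0 < l × iter act l x ≡ x × (∀ k → 0 < k → k < l → iter act k x ≢ x)

  HasCycleType : (s : ℕ) → (Fin s → ℕ) → Set
  HasCycleType s lam =
    Σ (Fin s → Fin r) λ rep →
      (∀ i j → SameCycle (rep i) (rep j) → i ≡ j) ×
      (∀ x → ∃ λ i → SameCycle (rep i) x) ×
      (∀ i → IsCycleLength (rep i) (lam i))

  Pt : Set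
  Pt = Fin r × Fin r

  sq : Pt → Pt
  sq (x , y) = (act (act x) , act (act y))

  SameOrbit : Pt → Pt → Set
  SameOrbit a b = ∃ λ k → iter sq k a ≡ b

  -- (x , y) ↦ (x , y) π τ = (yπ , xπ); so Γπτ = image of Γ under σ
  σ : Pt → Pt
  σ (x , y) = (act y , act x)

  FixedOrbit : Pt → Set
  FixedOrbit a = SameOrbit a (σ a)

  NonFixedOrbit : Pt → Set
  NonFixedOrbit a = ¬ SameOrbit a (σ a)

  -- a and b determine the same unordered pair {Γ , Γπτ}
  SamePair : Pt → Pt → Set
  SamePair a b = SameOrbit a b ⊎ SameOrbit (σ a) b

isEven : ℕ → Bool
isEven n = n % 2 ≡ᵇ 0

eN : ℕ → ℕ
eN n = if isEven n then 1 else 0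

fN : ℕ → ℕ
fN n = if n % 4 ≡ᵇ 2 then 1 else 0

eN2 : ℕ → ℕ → ℕ
eN2 m n = if isEven m ∨ isEven n then 1 else 0

-- η(λ) = Σ_i (1 - e_i + 2 f_i)   (1 - e_i ≥ 0 always)
eta : (s : ℕ) → (Fin s → ℕ) → ℕ
eta s lam = sumFin s (λ i → (1 ∸ eN (lam i)) + 2 * fN (lam i))

-- ζ(λ) = ½ Σ_i ((1+e_i)(λ_i+1) - 2(f_i+1)) + Σ_{i<j} (1+e_ij) gcd(λ_i,λ_j)
-- (for λ_i ≥ 1 each summand of the first sum is a nonnegative even number,
-- so truncated subtraction and floor division are exact)
zeta : (s : ℕ) → (Fin s → ℕ) → ℕ
zeta s lam =
  sumFin s (λ i → (1 + eN (lam i)) * (lam i + 1) ∸ 2 * (fN (lam i) + 1)) / 2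
  + sumFin s (λ i → sumFin s (λ j →
      if toℕ i <ᵇ toℕ j
      then (1 + eN2 (lam i) (lam j)) * gcd (lam i) (lam j)
      else 0))

module Submission where

-- Write a point of X × X in cycle coordinates (u , v) ∈ ℤ/λ_i × ℤ/λ_j; then π² shifts both
-- coordinates by 2, so by the Chinese remainder theorem the ⟨π²⟩-orbits in the block of the cycles
-- i and j have unique normal forms (p , p + d) with d < gcd (λ_i , λ_j) and p < 1 + e_ij.
-- The map Γ ↦ Γπτ exchanges the blocks (i , j) and (j , i), so for i ≠ j no orbit is fixed and the
-- (1 + e_ij) gcd (λ_i , λ_j) orbits of the block (i , j) represent the pairs.  On a diagonal block it
-- acts on normal forms as the involution τ (p , d) = (e_i (p + d + 1) mod 2 , −d mod λ_i), which has
-- 1 − e_i + 2 f_i fixed points; the other (1 + e_i) λ_i − (1 − e_i + 2 f_i) normal forms fall into pairs.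

open import Defs
open import Data.Nat using (ℕ; zero; suc; _+_; _*_; _∸_; _<_; _≤_; _%_; _/_; NonZero; >-nonZero; z≤n; s≤s; _<ᵇ_; _≡ᵇ_; pred)
open import Data.Nat.Properties
open import Data.Nat.DivMod
open import Data.Nat.Divisibility using (_∣_; divides; n∣m*n; ∣-trans; m%n≡0⇒n∣m)
open import Data.Nat.GCD using (gcd; module GCD; GCD; module Bézout; gcd-GCD; gcd[m,n]≢0)
open import Data.Nat.ListAction using (sum)
open import Data.Nat.Tactic.RingSolver using (solve-∀)
open import Data.Bool using (true; false; if_then_else_; _∨_; T)
open import Data.Unit using (tt)
open import Data.Empty using (⊥-elim)
open import Data.Fin using (Fin; toℕ; fromℕ<; splitAt; join) renaming (zero to fzero; suc to fsuc)
open import Data.Fin.Properties using (toℕ-injective; toℕ<n; toℕ-fromℕ<; splitAt-join; join-splitAt)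
import Data.Fin.Properties as Fin
open import Data.Fin.Permutation using (Permutation′; _⟨$⟩ʳ_; _⟨$⟩ˡ_; inverseˡ)
open import Data.List using (allFin)
open import Data.List.Properties using (map-tabulate; map-cong)
open import Data.Product using (∃; _×_; _,_; proj₁; proj₂)
open import Data.Sum using (_⊎_; inj₁; inj₂; [_,_]′)
open import Function using (_∘_)
open import Relation.Nullary using (¬_; yes; no; _×-dec_)
open import Relation.Binary.Definitions using (tri<; tri≈; tri>)
open import Relation.Binary.PropositionalEquality

sumFin-suc : ∀ s (f : Fin (suc s) → ℕ) → sumFin (suc s) f ≡ f fzero + sumFin s (f ∘ fsuc)
sumFin-suc s f = cong (λ l → f fzero + sum l)
  (trans (map-tabulate fsuc f) (sym (map-tabulate (λ i → i) (f ∘ fsuc))))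

sumFin-cong : ∀ n {f g : Fin n → ℕ} → (∀ i → f i ≡ g i) → sumFin n f ≡ sumFin n g
sumFin-cong n f≗g = cong sum (map-cong f≗g (allFin n))

sumFin-distribˡ-* : ∀ c n (f : Fin n → ℕ) → sumFin n (λ i → c * f i) ≡ c * sumFin n f
sumFin-distribˡ-* c zero f = sym (*-zeroʳ c)
sumFin-distribˡ-* c (suc n) f = begin
  sumFin (suc n) (λ i → c * f i)                 ≡⟨ sumFin-suc n (λ i → c * f i) ⟩
  c * f fzero + sumFin n (λ i → c * f (fsuc i))  ≡⟨ cong (c * f fzero +_) (sumFin-distribˡ-* c n (f ∘ fsuc)) ⟩
  c * f fzero + c * sumFin n (f ∘ fsuc)          ≡⟨ *-distribˡ-+ c (f fzero) _ ⟨
  c * (f fzero + sumFin n (f ∘ fsuc))            ≡⟨ cong (c *_) (sumFin-suc n f) ⟨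
  c * sumFin (suc n) f                           ∎
  where open ≡-Reasoning

module _ {A : Set} (R : A → A → Set) where

  NumClasses-⇔ : {P Q : A → Set} {n : ℕ} → (∀ a → P a → Q a) → (∀ a → Q a → P a) →
                 NumClasses R P n → NumClasses R Q n
  NumClasses-⇔ P⇒Q Q⇒P (rep , valid , distinct , cover) =
    rep , (λ i → P⇒Q _ (valid i)) , distinct , λ a q → cover a (Q⇒P a q)

  NumClasses-∅ : {P : A → Set} → (∀ a → ¬ P a) → NumClasses R P 0
  NumClasses-∅ ¬P = (λ ()) , (λ ()) , (λ ()) , λ a p → ⊥-elim (¬P a p)

  NumClasses-reps : (n : ℕ) (x : Fin n → A) → (∀ t t′ → R (x t) (x t′) → t ≡ t′) → (∀ a → R a a) →
                    NumClasses R (λ a → ∃ λ t → R (x t) a) n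
  NumClasses-reps n x distinct refl-R = x , (λ t → t , refl-R (x t)) , distinct , λ a p → p

  NumClasses-⊎ : {P Q : A → Set} {n k : ℕ} → NumClasses R P n → NumClasses R Q k →
                 (∀ a b → P a → Q b → ¬ R a b) → (∀ a b → P a → Q b → ¬ R b a) →
                 NumClasses R (λ a → P a ⊎ Q a) (n + k)
  NumClasses-⊎ {P} {Q} {n} {k} (repP , validP , distinctP , coverP) (repQ , validQ , distinctQ , coverQ)
               PQ QP =
    rep⊎ ∘ splitAt n , valid⊎ ∘ splitAt n , distinct , cover
    where
      rep⊎ : Fin n ⊎ Fin k → A
      rep⊎ = [ repP , repQ ]′

      valid⊎ : ∀ x → P (rep⊎ x) ⊎ Q (rep⊎ x)
      valid⊎ (inj₁ i) = inj₁ (validP i)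
      valid⊎ (inj₂ j) = inj₂ (validQ j)

      distinct⊎ : ∀ x y → R (rep⊎ x) (rep⊎ y) → x ≡ y
      distinct⊎ (inj₁ i) (inj₁ j) r = cong inj₁ (distinctP i j r)
      distinct⊎ (inj₂ i) (inj₂ j) r = cong inj₂ (distinctQ i j r)
      distinct⊎ (inj₁ i) (inj₂ j) r = ⊥-elim (PQ _ _ (validP i) (validQ j) r)
      distinct⊎ (inj₂ i) (inj₁ j) r = ⊥-elim (QP _ _ (validP j) (validQ i) r)

      distinct : ∀ i j → R (rep⊎ (splitAt n i)) (rep⊎ (splitAt n j)) → i ≡ j
      distinct i j r = begin
        i                      ≡⟨ join-splitAt n k i ⟨
        join n k (splitAt n i) ≡⟨ cong (join n k) (distinct⊎ (splitAt n i) (splitAt n j) r) ⟩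
        join n k (splitAt n j) ≡⟨ join-splitAt n k j ⟩
        j                      ∎
        where open ≡-Reasoning

      covered : ∀ a → (∃ λ x → R (rep⊎ x) a) → ∃ λ i → R (rep⊎ (splitAt n i)) a
      covered a (x , r) = join n k x , subst (λ y → R (rep⊎ y) a) (sym (splitAt-join n k x)) r

      cover : ∀ a → P a ⊎ Q a → ∃ λ i → R (rep⊎ (splitAt n i)) a
      cover a (inj₁ p) = covered a (let (i , r) = coverP a p in inj₁ i , r)
      cover a (inj₂ q) = covered a (let (j , r) = coverQ a q in inj₂ j , r)

  NumClasses-Σ : ∀ s (P : Fin s → A → Set) (n : Fin s → ℕ) → (∀ i → NumClasses R (P i) (n i)) →
                 (∀ i j a b → P i a → P j b → R a b → i ≡ j) →
                 NumClasses R (λ a → ∃ λ i → P i a) (sumFin s n)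
  NumClasses-Σ zero P n classes separated = NumClasses-∅ (λ { a (() , _) })
  NumClasses-Σ (suc s) P n classes separated =
    subst (NumClasses R _) (sym (sumFin-suc s n))
      (NumClasses-⇔ split unsplit
        (NumClasses-⊎ (classes fzero)
          (NumClasses-Σ s (P ∘ fsuc) (n ∘ fsuc) (classes ∘ fsuc)
            (λ i j a b p q r → Fin.suc-injective (separated _ _ a b p q r)))
          (λ { a b p (i , q) r → zero≢suc (separated _ _ a b p q r) })
          (λ { a b p (i , q) r → zero≢suc (sym (separated _ _ b a q p r)) })))
    where
      zero≢suc : ∀ {i : Fin s} → fzero ≢ fsuc i
      zero≢suc ()
      split : ∀ a → P fzero a ⊎ (∃ λ i → P (fsuc i) a) → ∃ λ i → P i a
      split a (inj₁ p) = fzero , p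
      split a (inj₂ (i , p)) = fsuc i , p
      unsplit : ∀ a → (∃ λ i → P i a) → P fzero a ⊎ (∃ λ i → P (fsuc i) a)
      unsplit a (fzero , p) = inj₁ p
      unsplit a (fsuc i , p) = inj₂ (i , p)

iter-+ : ∀ {A : Set} (f : A → A) u v x → iter f (u + v) x ≡ iter f u (iter f v x)
iter-+ f zero v x = refl
iter-+ f (suc u) v x = cong f (iter-+ f u v x)

iter-comm : ∀ {A : Set} (f : A → A) u v x → iter f u (iter f v x) ≡ iter f v (iter f u x)
iter-comm f u v x = begin
  iter f u (iter f v x) ≡⟨ iter-+ f u v x ⟨
  iter f (u + v) x      ≡⟨ cong (λ w → iter f w x) (+-comm u v) ⟩
  iter f (v + u) x      ≡⟨ iter-+ f v u x ⟩
  iter f v (iter f u x) ∎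
  where open ≡-Reasoning

iter-periodic : ∀ {A : Set} (f : A → A) P x → iter f P x ≡ x → ∀ q → iter f (q * P) x ≡ x
iter-periodic f P x fixed zero = refl
iter-periodic f P x fixed (suc q) =
  trans (iter-+ f P (q * P) x) (trans (cong (iter f P) (iter-periodic f P x fixed q)) fixed)

iter-undo : ∀ {A : Set} (f : A → A) P x → iter f P x ≡ x → 0 < P →
            ∀ k → iter f (k * P ∸ k) (iter f k x) ≡ x
iter-undo f P x fixed P>0 k = begin
  iter f (k * P ∸ k) (iter f k x) ≡⟨ iter-+ f (k * P ∸ k) k x ⟨
  iter f (k * P ∸ k + k) x        ≡⟨ cong (λ w → iter f w x) (m∸n+n≡m (m≤m*n k P {{>-nonZero P>0}})) ⟩
  iter f (k * P) x                ≡⟨ iter-periodic f P x fixed k ⟩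
  x                               ∎
  where open ≡-Reasoning

module _ {n : ℕ} .{{_ : NonZero n}} where

  m+an≡o+bn⇒m%n≡o%n : ∀ {x y} a b → x + a * n ≡ y + b * n → x % n ≡ y % n
  m+an≡o+bn⇒m%n≡o%n {x} {y} a b eq =
    trans (sym ([m+kn]%n≡m%n x a n)) (trans (cong (_% n) eq) ([m+kn]%n≡m%n y b n))

  +-congˡ-% : ∀ z {x y} → x % n ≡ y % n → (z + x) % n ≡ (z + y) % n
  +-congˡ-% z {x} {y} eq = begin
    (z + x) % n             ≡⟨ %-distribˡ-+ z x n ⟩
    (z % n + x % n) % n     ≡⟨ cong (λ w → (z % n + w) % n) eq ⟩
    (z % n + y % n) % n     ≡⟨ %-distribˡ-+ z y n ⟨
    (z + y) % n             ∎
    where open ≡-Reasoning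

  +-congʳ-% : ∀ z {x y} → x % n ≡ y % n → (x + z) % n ≡ (y + z) % n
  +-congʳ-% z {x} {y} eq =
    trans (cong (_% n) (+-comm x z)) (trans (+-congˡ-% z eq) (cong (_% n) (+-comm z y)))

  +-cancelˡ-% : ∀ z {x y} → (z + x) % n ≡ (z + y) % n → x % n ≡ y % n
  +-cancelˡ-% z {x} {y} eq =
    trans (sym (undo-z x)) (trans (+-congˡ-% (n ∸ z % n) eq) (undo-z y))
    where
      complement : ∀ w → (n ∸ z % n) + (z % n + (z / n) * n + w) ≡ w + suc (z / n) * n
      complement w = begin
        (n ∸ z % n) + (z % n + (z / n) * n + w) ≡⟨ rearrange (n ∸ z % n) (z % n) ((z / n) * n) w ⟩
        w + ((n ∸ z % n + z % n) + (z / n) * n) ≡⟨ cong (λ c → w + (c + (z / n) * n)) (m∸n+n≡m (m%n≤n z n)) ⟩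
        w + suc (z / n) * n                     ∎
        where
          open ≡-Reasoning
          rearrange : ∀ a b c w → a + (b + c + w) ≡ w + ((a + b) + c)
          rearrange = solve-∀
      undo-z : ∀ w → ((n ∸ z % n) + (z + w)) % n ≡ w % n
      undo-z w = m+an≡o+bn⇒m%n≡o%n 0 (suc (z / n))
        (trans (+-identityʳ _) (trans (cong (λ z′ → (n ∸ z % n) + (z′ + w)) (m≡m%n+[m/n]*n z n)) (complement w)))

  m%n≡o%n⇒m≡o : ∀ {x y} → x < n → y < n → x % n ≡ y % n → x ≡ y
  m%n≡o%n⇒m≡o x<n y<n eq = trans (sym (m<n⇒m%n≡m x<n)) (trans eq (m<n⇒m%n≡m y<n))

%≡⇒%≡-∣ : ∀ {g m} x y .{{_ : NonZero g}} .{{_ : NonZero m}} → g ∣ m → x % m ≡ y % m → x % g ≡ y % g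
%≡⇒%≡-∣ {g} {m} x y g∣m eq =
  trans (sym (m∣n⇒o%n%m≡o%m g m x g∣m)) (trans (cong (_% g) eq) (m∣n⇒o%n%m≡o%m g m y g∣m))

[2h+p]%2≡p%2 : ∀ h p → (2 * h + p) % 2 ≡ p % 2
[2h+p]%2≡p%2 h p = %-remove-+ˡ p (divides h (*-comm 2 h))

m≡2[m/2]+m%2 : ∀ x → x ≡ 2 * (x / 2) + x % 2
m≡2[m/2]+m%2 x = trans (m≡m%n+[m/n]*n x 2) (trans (+-comm (x % 2) _) (cong (_+ x % 2) (*-comm (x / 2) 2)))

parity : ∀ x → x % 2 ≡ 0 ⊎ x % 2 ≡ 1
parity x with x % 2 | m%n<n x 2
... | zero | _ = inj₁ refl
... | suc zero | _ = inj₂ refl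
... | suc (suc _) | s≤s (s≤s ())

odd*odd : ∀ {m n} → m % 2 ≡ 1 → n % 2 ≡ 1 → (m * n) % 2 ≡ 1
odd*odd {m} {n} m-odd n-odd = trans (%-distribˡ-* m n 2) (cong₂ (λ x y → (x * y) % 2) m-odd n-odd)

even-*[1+odd] : ∀ k {o} → o % 2 ≡ 1 → (k * (1 + o)) % 2 ≡ 0
even-*[1+odd] k {o} o-odd = begin
  (k * (1 + o)) % 2                  ≡⟨ %-distribˡ-* k (1 + o) 2 ⟩
  (k % 2 * ((1 + o) % 2)) % 2         ≡⟨ cong (λ z → (k % 2 * z) % 2) (+-congˡ-% {2} 1 {o} {1} o-odd) ⟩
  (k % 2 * 0) % 2                     ≡⟨ cong (_% 2) (*-zeroʳ (k % 2)) ⟩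
  0                                   ∎
  where open ≡-Reasoning

m%2≡0⇒2*[m/2]≡m : ∀ x → x % 2 ≡ 0 → 2 * (x / 2) ≡ x
m%2≡0⇒2*[m/2]≡m x even = sym (trans (m≡2[m/2]+m%2 x) (trans (cong (2 * (x / 2) +_) even) (+-identityʳ _)))

data ParityIndicator (m n e : ℕ) : Set where
  both-odd : e ≡ 0 → m % 2 ≡ 1 → n % 2 ≡ 1 → ParityIndicator m n e
  one-even : e ≡ 1 → m % 2 ≡ 0 ⊎ n % 2 ≡ 0 → ParityIndicator m n e

parityIndicator : ∀ m n → ParityIndicator m n (eN2 m n)
parityIndicator m n with parity m | parity n
... | inj₁ m-even | _ = one-even (cong (λ x → if (x ≡ᵇ 0) ∨ isEven n then 1 else 0) m-even) (inj₁ m-even)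
... | inj₂ m-odd | inj₁ n-even =
  one-even (cong₂ (λ x y → if (x ≡ᵇ 0) ∨ (y ≡ᵇ 0) then 1 else 0) m-odd n-even) (inj₂ n-even)
... | inj₂ m-odd | inj₂ n-odd =
  both-odd (cong₂ (λ x y → if (x ≡ᵇ 0) ∨ (y ≡ᵇ 0) then 1 else 0) m-odd n-odd) m-odd n-odd

-- the ⟨π²⟩-action in cycle coordinates: (u , v) ↦ (u + 2 , v + 2) on ℤ/m × ℤ/n
EvenShifted : ∀ m n .{{_ : NonZero m}} .{{_ : NonZero n}} → ℕ → ℕ → ℕ → ℕ → Set
EvenShifted m n u v u′ v′ = ∃ λ h → (2 * h + u) % m ≡ u′ % m × (2 * h + v) % n ≡ v′ % n

module EvenShift (m′ n′ g′ : ℕ) where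

  m n g : ℕ
  m = suc m′
  n = suc n′
  g = suc g′

  even-plus-parity : ∀ {e} → ParityIndicator m n e → ∀ k →
                     ∃ λ p → ∃ λ h → p < 1 + e × (2 * h + p) % m ≡ k % m × (2 * h + p) % n ≡ k % n
  even-plus-parity (one-even refl _) k =
    k % 2 , k / 2 , m%n<n k 2 , cong (_% m) (sym (m≡2[m/2]+m%2 k)) , cong (_% n) (sym (m≡2[m/2]+m%2 k))
  even-plus-parity (both-odd refl m-odd n-odd) k = 0 , K / 2 , s≤s z≤n ,
        trans 2h≡K (trans (cong (_% m) (K≡k+kn*m k m n)) ([m+kn]%n≡m%n k (k * n) m)) ,
        trans 2h≡K (trans (cong (_% n) (K≡k+km*n k m n)) ([m+kn]%n≡m%n k (k * m) n))
    where
      K = k * (1 + m * n)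
      2h≡K : ∀ {o} .{{_ : NonZero o}} → (2 * (K / 2) + 0) % o ≡ K % o
      2h≡K {o} = cong (_% o) (trans (+-identityʳ _)
                   (m%2≡0⇒2*[m/2]≡m K (even-*[1+odd] k {m * n} (odd*odd {m} {n} m-odd n-odd))))
      K≡k+kn*m : ∀ k m n → k * (1 + m * n) ≡ k + k * n * m
      K≡k+kn*m = solve-∀
      K≡k+km*n : ∀ k m n → k * (1 + m * n) ≡ k + k * m * n
      K≡k+km*n = solve-∀

  module _ (isGCD : GCD m n g) where

    private
      g∣m : g ∣ m
      g∣m = GCD.gcd∣m isGCD
      g∣n : g ∣ n
      g∣n = GCD.gcd∣n isGCD

    multiple≡gcd-multiple : ∀ t → ∃ λ a → (a * m) % n ≡ (t * g) % n
    multiple≡gcd-multiple t with Bézout.identity isGCD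
    ... | Bézout.+- x y eq = t * x , m+an≡o+bn⇒m%n≡o%n 0 (t * y)
      (trans (+-identityʳ _) (trans (*-assoc t x m) (trans (cong (t *_) (sym eq)) (distrib t g y n))))
      where distrib : ∀ t g y n → t * (g + y * n) ≡ t * g + t * y * n
            distrib = solve-∀
    ... | Bézout.-+ x y eq = t * x * n′ , m+an≡o+bn⇒m%n≡o%n (t * y) (t * x * m)
      (trans (cong (t * x * n′ * m +_) (*-assoc t y n))
        (trans (cong (λ z → t * x * n′ * m + t * z) (sym eq)) (distrib t x n′ m g)))
      where distrib : ∀ t x n′ m g → t * x * n′ * m + t * (g + x * m) ≡ t * g + t * x * m * suc n′
            distrib = solve-∀

    -- representative of b ∸ a modulo g (computed without subtraction)
    gap : ℕ → ℕ → ℕ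
    gap a b = (b + n′ * a) % g

    gap<g : ∀ a b → gap a b < g
    gap<g a b = m%n<n (b + n′ * a) g

    private
      +gap≡ : ∀ a b → (a + gap a b) % g ≡ b % g
      +gap≡ a b = begin
        (a + gap a b) % g       ≡⟨ +-congˡ-% a (m%n%n≡m%n (b + n′ * a) g) ⟩
        (a + (b + n′ * a)) % g  ≡⟨ cong (_% g) (rearrange a b n′) ⟩
        (b + a * n) % g         ≡⟨ %-remove-+ʳ b (∣-trans g∣n (n∣m*n a)) ⟩
        b % g                   ∎
        where
          open ≡-Reasoning
          rearrange : ∀ a b n′ → a + (b + n′ * a) ≡ b + a * suc n′
          rearrange = solve-∀

    -- solvable because a ≡ b − gap a b (mod g)
    chinese-remainder : ∀ a b → ∃ λ k → k % m ≡ a % m × (k + gap a b) % n ≡ b % n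
    chinese-remainder a b = solution (m%n≡0⇒n∣m c g c%g≡0)
      where
        s = a + gap a b
        c = b + n′ * s
        s+c≡b+sn : ∀ s b n′ → s + (b + n′ * s) ≡ b + s * suc n′
        s+c≡b+sn = solve-∀
        c%g≡0 : c % g ≡ 0
        c%g≡0 = +-cancelˡ-% s (begin
          (s + c) % g     ≡⟨ cong (_% g) (s+c≡b+sn s b n′) ⟩
          (b + s * n) % g ≡⟨ %-remove-+ʳ b (∣-trans g∣n (n∣m*n s)) ⟩
          b % g           ≡⟨ +gap≡ a b ⟨
          s % g           ≡⟨ cong (_% g) (+-identityʳ s) ⟨
          (s + 0) % g     ∎)
          where open ≡-Reasoning
        solution : g ∣ c → ∃ λ k → k % m ≡ a % m × (k + gap a b) % n ≡ b % n
        solution (divides t c≡tg) =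
          let (A , Am≡tg) = multiple≡gcd-multiple t
          in A * m + a , %-remove-+ˡ a (n∣m*n A) , (begin
            (A * m + a + gap a b) % n   ≡⟨ cong (_% n) (+-assoc (A * m) a (gap a b)) ⟩
            (A * m + s) % n             ≡⟨ +-congʳ-% s {A * m} {c} (trans Am≡tg (cong (_% n) (sym c≡tg))) ⟩
            (c + s) % n                 ≡⟨ cong (_% n) (trans (+-comm c s) (s+c≡b+sn s b n′)) ⟩
            (b + s * n) % n             ≡⟨ [m+kn]%n≡m%n b s n ⟩
            b % n                       ∎)
          where open ≡-Reasoning

    normalForm : ∀ {e} → ParityIndicator m n e → ∀ a b →
                 ∃ λ p → ∃ λ d → p < 1 + e × d < g × EvenShifted m n p (p + d) a b
    normalForm ind a b with chinese-remainder a b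
    ... | k , k≡a , k+gap≡b with even-plus-parity ind k
    ... | p , h , p<1+e , ≡k[m] , ≡k[n] = p , gap a b , p<1+e , gap<g a b , h , trans ≡k[m] k≡a ,
          trans (cong (_% n) (sym (+-assoc (2 * h) p (gap a b))))
                (trans (+-congʳ-% {n} (gap a b) {2 * h + p} {k} ≡k[n]) k+gap≡b)

    normalForm-gap-unique : ∀ {p p′ d d′} → d < g → d′ < g →
                            EvenShifted m n p (p + d) p′ (p′ + d′) → d ≡ d′
    normalForm-gap-unique {p} {p′} {d} {d′} d<g d′<g (h , ≡[m] , ≡[n]) =
      m%n≡o%n⇒m≡o d<g d′<g (+-cancelˡ-% p′ (begin
        (p′ + d) % g        ≡⟨ +-congʳ-% {g} d {p′} {x} (sym (%≡⇒%≡-∣ x p′ g∣m ≡[m])) ⟩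
        (x + d) % g         ≡⟨ %≡⇒%≡-∣ (x + d) (p′ + d′) g∣n (trans (cong (_% n) (+-assoc (2 * h) p d)) ≡[n]) ⟩
        (p′ + d′) % g       ∎))
      where
        open ≡-Reasoning
        x = 2 * h + p

    normalForm-parity-unique : ∀ {e} → ParityIndicator m n e → ∀ {p p′ d} → p < 1 + e → p′ < 1 + e →
                               EvenShifted m n p (p + d) p′ (p′ + d) → p ≡ p′
    normalForm-parity-unique (both-odd refl _ _) p<1 p′<1 _ = trans (n<1⇒n≡0 p<1) (sym (n<1⇒n≡0 p′<1))
    normalForm-parity-unique (one-even refl (inj₁ m-even)) {p} {p′} p<2 p′<2 (h , ≡[m] , _) =
      m%n≡o%n⇒m≡o p<2 p′<2 (begin
        p % 2               ≡⟨ [2h+p]%2≡p%2 h p ⟨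
        (2 * h + p) % 2     ≡⟨ %≡⇒%≡-∣ (2 * h + p) p′ (m%n≡0⇒n∣m m 2 m-even) ≡[m] ⟩
        p′ % 2              ∎)
      where open ≡-Reasoning
    normalForm-parity-unique (one-even refl (inj₂ n-even)) {p} {p′} {d} p<2 p′<2 (h , _ , ≡[n]) =
      m%n≡o%n⇒m≡o p<2 p′<2 (+-cancelˡ-% d (begin
        (d + p) % 2         ≡⟨ cong (_% 2) (+-comm d p) ⟩
        (p + d) % 2         ≡⟨ [2h+p]%2≡p%2 h (p + d) ⟨
        (2 * h + (p + d)) % 2 ≡⟨ %≡⇒%≡-∣ (2 * h + (p + d)) (p′ + d) (m%n≡0⇒n∣m n 2 n-even) ≡[n] ⟩
        (p′ + d) % 2        ≡⟨ cong (_% 2) (+-comm p′ d) ⟩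
        (d + p′) % 2        ∎))
      where open ≡-Reasoning

    normalForm-unique : ∀ {e} → ParityIndicator m n e → ∀ {p p′ d d′} →
                        p < 1 + e → p′ < 1 + e → d < g → d′ < g →
                        EvenShifted m n p (p + d) p′ (p′ + d′) → p ≡ p′ × d ≡ d′
    normalForm-unique ind {p′ = p′} p< p′< d< d′< shifted with normalForm-gap-unique {p′ = p′} d< d′< shifted
    ... | refl = normalForm-parity-unique ind p< p′< shifted , refl

-- The diagonal block of a cycle of length m: the normal form (p , d) stands for the orbit of
-- (π^p x , π^(p+d) x), and τ computes the normal form of its image under (u , v) ↦ (vπ , uπ).
module DiagonalInvolution (m′ e : ℕ) where

  m : ℕ
  m = suc m′

  IsNormal : ℕ × ℕ → Set
  IsNormal (p , d) = p < 1 + e × d < m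

  τ-parity : ℕ → ℕ → ℕ
  τ-parity p d = e * (suc (p + d) % 2)

  τ-gap : ℕ → ℕ
  τ-gap d = (m ∸ d) % m

  τ : ℕ × ℕ → ℕ × ℕ
  τ (p , d) = τ-parity p d , τ-gap d

  τ-gap-zero : τ-gap 0 ≡ 0
  τ-gap-zero = n%n≡0 m

  τ-gap<m : ∀ d → τ-gap d < m
  τ-gap<m d = m%n<n (m ∸ d) m

  τ-gap-pos : ∀ {d} → 0 < d → d < m → τ-gap d ≡ m ∸ d
  τ-gap-pos {d} 0<d d<m = m<n⇒m%n≡m (∸-monoʳ-< {m} {d} {0} 0<d (<⇒≤ d<m))

  τ-gap+gap : ∀ {d} → 0 < d → d < m → τ-gap d + d ≡ m
  τ-gap+gap {d} 0<d d<m = trans (cong (_+ d) (τ-gap-pos 0<d d<m)) (m∸n+n≡m (<⇒≤ d<m))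

  τ-gap-involutive : ∀ {d} → d < m → τ-gap (τ-gap d) ≡ d
  τ-gap-involutive {zero} _ = trans (cong τ-gap τ-gap-zero) τ-gap-zero
  τ-gap-involutive {suc d} d<m = begin
    τ-gap (τ-gap (suc d))  ≡⟨ cong τ-gap (τ-gap-pos (s≤s z≤n) d<m) ⟩
    τ-gap (m ∸ suc d)      ≡⟨ τ-gap-pos (m<n⇒0<n∸m d<m) (∸-monoʳ-< {m} {suc d} {0} (s≤s z≤n) (<⇒≤ d<m)) ⟩
    m ∸ (m ∸ suc d)        ≡⟨ m∸[m∸n]≡n (<⇒≤ d<m) ⟩
    suc d                  ∎
    where open ≡-Reasoning

  τ-normal : ParityIndicator m m e → ∀ {z} → IsNormal z → IsNormal (τ z)
  τ-normal (both-odd refl _ _) {p , d} _ = s≤s z≤n , τ-gap<m d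
  τ-normal (one-even refl _) {p , d} _ = subst (_< 2) (sym (+-identityʳ _)) (m%n<n (suc (p + d)) 2) , τ-gap<m d

  private
    second-coordinate : ∀ p d h x → d < m → (2 * h + x) % m ≡ suc (p + d) % m →
                        (2 * h + (x + τ-gap d)) % m ≡ suc p % m
    second-coordinate p d h x d<m first = begin
      (2 * h + (x + τ-gap d)) % m     ≡⟨ cong (_% m) (+-assoc (2 * h) x (τ-gap d)) ⟨
      (2 * h + x + τ-gap d) % m       ≡⟨ +-congʳ-% (τ-gap d) {2 * h + x} {suc (p + d)} first ⟩
      (suc (p + d) + τ-gap d) % m     ≡⟨ +-congˡ-% (suc (p + d)) {τ-gap d} {m ∸ d} (m%n%n≡m%n (m ∸ d) m) ⟩
      (suc (p + d) + (m ∸ d)) % m     ≡⟨ cong (_% m) (rearrange p d (m ∸ d)) ⟩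
      (suc p + (m ∸ d + d)) % m       ≡⟨ cong (λ z → (suc p + z) % m) (m∸n+n≡m (<⇒≤ d<m)) ⟩
      (suc p + m) % m                 ≡⟨ [m+n]%n≡m%n (suc p) m ⟩
      suc p % m                       ∎
      where
        open ≡-Reasoning
        rearrange : ∀ p d w → suc (p + d) + w ≡ suc p + (w + d)
        rearrange = solve-∀

  τ-normalises-swap : ParityIndicator m m e → ∀ {p d} → IsNormal (p , d) →
                      EvenShifted m m (τ-parity p d) (τ-parity p d + τ-gap d) (suc (p + d)) (suc p)
  τ-normalises-swap (one-even refl _) {p} {d} (_ , d<m) = x / 2 , first , second-coordinate p d (x / 2) _ d<m first
    where
      x = suc (p + d)
      first : (2 * (x / 2) + τ-parity p d) % m ≡ x % m
      first = cong (_% m) (trans (cong (2 * (x / 2) +_) (+-identityʳ (x % 2))) (sym (m≡2[m/2]+m%2 x)))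
  τ-normalises-swap (both-odd refl m-odd _) {p} {d} (p<1 , d<m) =
    K / 2 , first , second-coordinate p d (K / 2) 0 d<m first
    where
      -- an even number congruent to suc d modulo the odd m
      K = suc d * (1 + m)
      K-even : K % 2 ≡ 0
      K-even = even-*[1+odd] (suc d) {m} m-odd
      first : (2 * (K / 2) + 0) % m ≡ suc (p + d) % m
      first = begin
        (2 * (K / 2) + 0) % m   ≡⟨ cong (_% m) (trans (+-identityʳ _) (m%2≡0⇒2*[m/2]≡m K K-even)) ⟩
        K % m                   ≡⟨ cong (_% m) (expand d m) ⟩
        (suc d + suc d * m) % m ≡⟨ [m+kn]%n≡m%n (suc d) (suc d) m ⟩
        suc d % m               ≡⟨ cong (λ q → suc (q + d) % m) (n<1⇒n≡0 p<1) ⟨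
        suc (p + d) % m         ∎
        where
          open ≡-Reasoning
          expand : ∀ d m → suc d * (1 + m) ≡ suc d + suc d * m
          expand = solve-∀

  record Classification (f : ℕ) : Set where
    field
      indicator : ParityIndicator m m e
      #fixed : ℕ
      fixed : Fin #fixed → ℕ × ℕ
      fixed-normal : ∀ t → IsNormal (fixed t)
      fixed-τ : ∀ t → τ (fixed t) ≡ fixed t
      fixed-injective : ∀ t t′ → fixed t ≡ fixed t′ → t ≡ t′
      fixed-complete : ∀ z → IsNormal z → τ z ≡ z → ∃ λ t → fixed t ≡ z
      #pairs : ℕ
      pair : Fin #pairs → ℕ × ℕ
      pair-normal : ∀ t → IsNormal (pair t)
      pair-τ : ∀ t t′ → τ (pair t) ≢ pair t′
      pair-injective : ∀ t t′ → pair t ≡ pair t′ → t ≡ t′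
      pair-complete : ∀ z → IsNormal z → τ z ≢ z → ∃ λ t → pair t ≡ z ⊎ τ (pair t) ≡ z
      #fixed≡ : #fixed ≡ 1 ∸ e + 2 * f
      2*#pairs≡ : 2 * #pairs ≡ (1 + e) * (m + 1) ∸ 2 * (f + 1)

-- m = 2k + 1: the only fixed normal form is (0 , 0), and (0 , d) is paired with (0 , m ∸ d)
module OddDiagonal (k : ℕ) where

  open DiagonalInvolution (2 * k) 0

  τ-gap-fixed⇒≡0 : ∀ {d} → d < m → τ-gap d ≡ d → d ≡ 0
  τ-gap-fixed⇒≡0 {zero} _ _ = refl
  τ-gap-fixed⇒≡0 {suc d} d<m fixed = ⊥-elim (even≢odd (suc d) k (begin
    2 * suc d        ≡⟨ cong (suc d +_) (+-identityʳ (suc d)) ⟩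
    suc d + suc d    ≡⟨ cong (_+ suc d) fixed ⟨
    τ-gap (suc d) + suc d ≡⟨ τ-gap+gap (s≤s z≤n) d<m ⟩
    suc (2 * k)      ∎))
    where open ≡-Reasoning

  fixed-complete : ∀ z → IsNormal z → τ z ≡ z → ∃ λ (t : Fin 1) → (0 , 0) ≡ z
  fixed-complete (p , d) (p<1 , d<m) fixed =
    fzero , cong₂ _,_ (sym (n<1⇒n≡0 p<1)) (sym (τ-gap-fixed⇒≡0 d<m (cong proj₂ fixed)))

  pair : Fin k → ℕ × ℕ
  pair t = 0 , suc (toℕ t)

  pair-normal : ∀ t → IsNormal (pair t)
  pair-normal t = s≤s z≤n , s≤s (≤-trans (toℕ<n t) (m≤m+n k (k + 0)))

  pair-τ : ∀ t t′ → τ (pair t) ≢ pair t′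
  pair-τ t t′ eq = <-irrefl refl (begin-strict
    suc (2 * k)                        ≡⟨ τ-gap+gap (s≤s z≤n) (proj₂ (pair-normal t)) ⟨
    τ-gap (suc (toℕ t)) + suc (toℕ t)  ≡⟨ cong (_+ suc (toℕ t)) (cong proj₂ eq) ⟩
    suc (toℕ t′) + suc (toℕ t)         <⟨ s≤s (+-mono-≤ (toℕ<n t′) (≤-trans (toℕ<n t) (m≤m+n k 0))) ⟩
    suc (2 * k)                        ∎)
    where open ≤-Reasoning

  pair-complete : ∀ z → IsNormal z → τ z ≢ z → ∃ λ t → pair t ≡ z ⊎ τ (pair t) ≡ z
  pair-complete (p , zero) (p<1 , _) non-fixed rewrite n<1⇒n≡0 p<1 =
    ⊥-elim (non-fixed (cong (0 ,_) τ-gap-zero))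
  pair-complete (p , suc d) (p<1 , d<m) non-fixed rewrite n<1⇒n≡0 p<1 with d <? k
  ... | yes d<k = fromℕ< d<k , inj₁ (cong (λ z → 0 , suc z) (toℕ-fromℕ< d<k))
  ... | no d≮k = image-of (τ-gap (suc d)) refl
    where
      image-of : ∀ W → τ-gap (suc d) ≡ W → ∃ λ t → pair t ≡ (0 , suc d) ⊎ τ (pair t) ≡ (0 , suc d)
      image-of zero W≡0 = ⊥-elim (<-irrefl (trans (sym (cong (_+ suc d) W≡0)) (τ-gap+gap (s≤s z≤n) d<m)) d<m)
      image-of (suc w) W≡ = fromℕ< w<k , inj₂ (cong (0 ,_) τ-pair≡)
        where
          w<k : w < k
          w<k = +-cancelʳ-≤ k (suc w) k (≤-pred (begin
            suc (suc w + k)       ≤⟨ s≤s (+-monoʳ-≤ (suc w) (≮⇒≥ d≮k)) ⟩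
            suc (suc w + d)       ≡⟨ +-suc (suc w) d ⟨
            suc w + suc d         ≡⟨ cong (_+ suc d) W≡ ⟨
            τ-gap (suc d) + suc d ≡⟨ τ-gap+gap (s≤s z≤n) d<m ⟩
            suc (k + (k + 0))     ≡⟨ cong (λ x → suc (k + x)) (+-identityʳ k) ⟩
            suc (k + k)           ∎))
            where open ≤-Reasoning
          τ-pair≡ : τ-gap (suc (toℕ (fromℕ< w<k))) ≡ suc d
          τ-pair≡ = begin
            τ-gap (suc (toℕ (fromℕ< w<k))) ≡⟨ cong (λ x → τ-gap (suc x)) (toℕ-fromℕ< w<k) ⟩
            τ-gap (suc w)                  ≡⟨ cong τ-gap W≡ ⟨
            τ-gap (τ-gap (suc d))          ≡⟨ τ-gap-involutive d<m ⟩
            suc d                          ∎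
            where open ≡-Reasoning

  classification : Classification 0
  classification = record
    { indicator = both-odd refl m-odd m-odd
    ; #fixed = 1
    ; fixed = λ _ → 0 , 0
    ; fixed-normal = λ _ → s≤s z≤n , s≤s z≤n
    ; fixed-τ = λ _ → cong (0 ,_) τ-gap-zero
    ; fixed-injective = λ { fzero fzero _ → refl }
    ; fixed-complete = fixed-complete
    ; #pairs = k
    ; pair = pair
    ; pair-normal = pair-normal
    ; pair-τ = pair-τ
    ; pair-injective = λ t t′ eq → toℕ-injective (suc-injective (cong proj₂ eq))
    ; pair-complete = pair-complete
    ; #fixed≡ = refl
    ; 2*#pairs≡ = sym (cong (_∸ 2) (count k))
    }
    where
      m-odd : m % 2 ≡ 1
      m-odd = trans (cong (_% 2) (+-comm 1 (2 * k))) (%-remove-+ˡ 1 (divides k (*-comm 2 k)))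
      count : ∀ k → (1 + 0) * (suc (2 * k) + 1) ≡ 2 + 2 * k
      count = solve-∀

data HalfParity (K : ℕ) : ℕ → Set where
  half-odd : K % 2 ≡ 1 → HalfParity K 1
  half-even : K % 2 ≡ 0 → HalfParity K 0

-- m = 2K: (p , d) is coded by 2d + p; the representatives of the pairs are the codes 1, …, 2K ∸ f
module EvenDiagonal (K′ : ℕ) where

  K : ℕ
  K = suc K′

  open DiagonalInvolution (pred (2 * K)) 1

  code : ℕ × ℕ → ℕ
  code (p , d) = 2 * d + p

  decode : ℕ → ℕ × ℕ
  decode u = u % 2 , u / 2

  code-decode : ∀ u → code (decode u) ≡ u
  code-decode u = sym (m≡2[m/2]+m%2 u)

  decode-code : ∀ {p d} → p < 2 → decode (code (p , d)) ≡ (p , d)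
  decode-code {p} {d} p<2 = cong₂ _,_
    (trans ([2h+p]%2≡p%2 d p) (m<n⇒m%n≡m p<2))
    (begin
      (2 * d + p) / 2     ≡⟨ +-distrib-/-∣ˡ p (divides d (*-comm 2 d)) ⟩
      2 * d / 2 + p / 2   ≡⟨ cong₂ _+_ (trans (cong (_/ 2) (*-comm 2 d)) (m*n/n≡m d 2)) (m<n⇒m/n≡0 p<2) ⟩
      d + 0               ≡⟨ +-identityʳ d ⟩
      d                   ∎)
    where open ≡-Reasoning

  m-even : m % 2 ≡ 0
  m-even = trans (cong (_% 2) (*-comm 2 K)) (m*n%n≡0 K 2)

  K<m : K < m
  K<m = m<m+n K (s≤s z≤n)

  τ-gap-K : τ-gap K ≡ K
  τ-gap-K = trans (τ-gap-pos (s≤s z≤n) K<m) (trans (m+n∸m≡n K (K + 0)) (+-identityʳ K))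

  τ-parity≡ : ∀ p d → τ-parity p d ≡ suc (p + d) % 2
  τ-parity≡ p d = +-identityʳ _

  τ-parity-gap-zero : ∀ p → p < 2 → τ-parity p 0 ≢ p
  τ-parity-gap-zero zero _ ()
  τ-parity-gap-zero (suc zero) _ ()
  τ-parity-gap-zero (suc (suc _)) (s≤s (s≤s ()))

  τ-parity-involutive : ∀ {p d} → p < 2 → d < m → τ-parity (τ-parity p d) (τ-gap d) ≡ p
  τ-parity-involutive {p} {zero} p<2 _ = trans (cong (τ-parity (τ-parity p 0)) τ-gap-zero) (by-cases p p<2)
    where
      by-cases : ∀ p → p < 2 → τ-parity (τ-parity p 0) 0 ≡ p
      by-cases zero _ = refl
      by-cases (suc zero) _ = refl
      by-cases (suc (suc _)) (s≤s (s≤s ()))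
  τ-parity-involutive {p} {suc d} p<2 d<m = begin
    τ-parity (τ-parity p D) W       ≡⟨ τ-parity≡ (τ-parity p D) W ⟩
    (1 + (τ-parity p D + W)) % 2    ≡⟨ +-congˡ-% {2} 1 {τ-parity p D + W} {suc (p + D) + W}
                                          (+-congʳ-% {2} W {τ-parity p D} {suc (p + D)} parity-D) ⟩
    (1 + (suc (p + D) + W)) % 2     ≡⟨ cong (_% 2) (rearrange p D W) ⟩
    (p + (W + D) + 1 * 2) % 2       ≡⟨ [m+kn]%n≡m%n (p + (W + D)) 1 2 ⟩
    (p + (W + D)) % 2               ≡⟨ cong (λ z → (p + z) % 2) (τ-gap+gap (s≤s z≤n) d<m) ⟩
    (p + m) % 2                     ≡⟨ +-congˡ-% {2} p {m} {0} m-even ⟩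
    (p + 0) % 2                     ≡⟨ cong (_% 2) (+-identityʳ p) ⟩
    p % 2                           ≡⟨ m<n⇒m%n≡m p<2 ⟩
    p                               ∎
    where
      open ≡-Reasoning
      D = suc d
      W = τ-gap D
      parity-D : τ-parity p D % 2 ≡ suc (p + D) % 2
      parity-D = trans (cong (_% 2) (τ-parity≡ p D)) (m%n%n≡m%n (suc (p + D)) 2)
      rearrange : ∀ p D W → 1 + (suc (p + D) + W) ≡ p + (W + D) + 1 * 2
      rearrange = solve-∀

  τ-involutive : ∀ {z} → IsNormal z → τ (τ z) ≡ z
  τ-involutive (p<2 , d<m) = cong₂ _,_ (τ-parity-involutive p<2 d<m) (τ-gap-involutive d<m)

  τ-gap-fixed⇒≡K : ∀ {d} → 0 < d → d < m → τ-gap d ≡ d → d ≡ K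
  τ-gap-fixed⇒≡K {d} 0<d d<m fixed = *-cancelˡ-≡ d K 2 (begin
    d + (d + 0)   ≡⟨ cong (d +_) (+-identityʳ d) ⟩
    d + d         ≡⟨ cong (_+ d) fixed ⟨
    τ-gap d + d   ≡⟨ τ-gap+gap 0<d d<m ⟩
    2 * K         ∎)
    where open ≡-Reasoning

  τ-fixed⇒ : ∀ {p d} → p < 2 → d < m → τ (p , d) ≡ (p , d) → d ≡ K × K % 2 ≡ 1
  τ-fixed⇒ {p} {zero} p<2 _ fixed = ⊥-elim (τ-parity-gap-zero p p<2 (cong proj₁ fixed))
  τ-fixed⇒ {p} {suc d} p<2 d<m fixed with parity K
  ... | inj₂ K-odd = τ-gap-fixed⇒≡K (s≤s z≤n) d<m (cong proj₂ fixed) , K-odd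
  ... | inj₁ K-even = ⊥-elim (τ-parity-gap-zero p p<2 (begin
    τ-parity p 0            ≡⟨ τ-parity≡ p 0 ⟩
    (suc p + 0) % 2         ≡⟨ +-congˡ-% {2} (suc p) {0} {K} (sym K-even) ⟩
    (suc p + K) % 2         ≡⟨ cong (λ x → (suc p + x) % 2) (τ-gap-fixed⇒≡K (s≤s z≤n) d<m (cong proj₂ fixed)) ⟨
    suc (p + suc d) % 2     ≡⟨ τ-parity≡ p (suc d) ⟨
    τ-parity p (suc d)      ≡⟨ cong proj₁ fixed ⟩
    p                       ∎))
    where open ≡-Reasoning

  τ-fixed⇐ : ∀ {p} → K % 2 ≡ 1 → p < 2 → τ (p , K) ≡ (p , K)
  τ-fixed⇐ {p} K-odd p<2 = cong₂ _,_ (begin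
    τ-parity p K        ≡⟨ τ-parity≡ p K ⟩
    (suc p + K) % 2     ≡⟨ +-congˡ-% {2} (suc p) {K} {1} K-odd ⟩
    (suc p + 1) % 2     ≡⟨ by-cases p p<2 ⟩
    p                   ∎) τ-gap-K
    where
      open ≡-Reasoning
      by-cases : ∀ p → p < 2 → (suc p + 1) % 2 ≡ p
      by-cases zero _ = refl
      by-cases (suc zero) _ = refl
      by-cases (suc (suc _)) (s≤s (s≤s ()))

  #pairs : ℕ → ℕ
  #pairs f = 2 * K ∸ f

  #pairs≤ : ∀ f → #pairs f ≤ 2 * K
  #pairs≤ f = m∸n≤m (2 * K) f

  2K≤1+#pairs : ∀ {f} → HalfParity K f → 2 * K ≤ suc (#pairs f)
  2K≤1+#pairs (half-odd _) = ≤-reflexive (refl {x = 2 * K})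
  2K≤1+#pairs (half-even _) = n≤1+n (2 * K)

  InRange : ℕ → ℕ × ℕ → Set
  InRange f z = 1 ≤ code z × code z ≤ #pairs f

  code<2K : ∀ {p d} → p < 2 → d < K → code (p , d) < 2 * K
  code<2K {p} {d} (s≤s p≤1) (s≤s d≤K′) = begin-strict
    2 * d + p       ≤⟨ +-mono-≤ (*-monoʳ-≤ 2 d≤K′) p≤1 ⟩
    2 * K′ + 1      <⟨ ≤-reflexive (expand K′) ⟩
    2 * K           ∎
    where
      open ≤-Reasoning
      expand : ∀ K′ → suc (2 * K′ + 1) ≡ 2 * suc K′
      expand = solve-∀

  code>2K : ∀ {p d} → K < d → 2 * K < code (p , d)
  code>2K {p} {d} K<d = begin-strict
    2 * K       <⟨ *-monoʳ-< 2 (n<1+n K) ⟩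
    2 * suc K   ≤⟨ *-monoʳ-≤ 2 K<d ⟩
    2 * d       ≤⟨ m≤m+n (2 * d) p ⟩
    2 * d + p   ∎
    where open ≤-Reasoning

  code<2K⇒≤#pairs : ∀ {f} z → HalfParity K f → code z < 2 * K → code z ≤ #pairs f
  code<2K⇒≤#pairs z hp code< = ≤-pred (≤-trans code< (2K≤1+#pairs hp))

  τ-gap-flips-below : ∀ {d} → 0 < d → d < K → K < τ-gap d
  τ-gap-flips-below {d} 0<d d<K = +-cancelʳ-< d K (τ-gap d) (begin-strict
    K + d          <⟨ +-monoʳ-< K d<K ⟩
    K + K          ≡⟨ cong (K +_) (+-identityʳ K) ⟨
    2 * K          ≡⟨ τ-gap+gap 0<d (<-trans d<K K<m) ⟨
    τ-gap d + d    ∎)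
    where open ≤-Reasoning

  τ-gap-flips-above : ∀ {d} → K < d → d < m → τ-gap d < K
  τ-gap-flips-above {d} K<d d<m = +-cancelʳ-< d (τ-gap d) K (begin-strict
    τ-gap d + d    ≡⟨ τ-gap+gap (<-trans (s≤s z≤n) K<d) d<m ⟩
    2 * K          ≡⟨ cong (K +_) (+-identityʳ K) ⟩
    K + K          <⟨ +-monoʳ-< K K<d ⟩
    K + d          ∎)
    where open ≤-Reasoning

  τ-leaves-range : ∀ {f z} → HalfParity K f → IsNormal z → τ z ≢ z → InRange f z → ¬ InRange f (τ z)
  τ-leaves-range {z = zero , zero} _ _ _ (() , _)
  τ-leaves-range {z = suc zero , zero} _ _ _ _ (1≤code , _) =
    <-irrefl (sym (cong (λ d → 2 * d + 0) τ-gap-zero)) 1≤code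
  τ-leaves-range {z = suc (suc _) , zero} _ (s≤s (s≤s ()) , _)
  τ-leaves-range {f} {p , suc d} hp (p<2 , d<m) non-fixed (_ , in-range) (_ , τ-in-range)
    with <-cmp (suc d) K
  ... | tri< d<K _ _ = <-irrefl refl (begin-strict
    #pairs f            ≤⟨ #pairs≤ f ⟩
    2 * K               <⟨ code>2K (τ-gap-flips-below (s≤s z≤n) d<K) ⟩
    code (τ (p , suc d)) ≤⟨ τ-in-range ⟩
    #pairs f            ∎)
    where open ≤-Reasoning
  ... | tri> _ _ K<d = <-irrefl refl (≤-<-trans in-range (≤-<-trans (#pairs≤ f) (code>2K K<d)))
  ... | tri≈ _ refl _ with hp
  ...   | half-odd K-odd = non-fixed (τ-fixed⇐ K-odd p<2)
  ...   | half-even K-even = <-irrefl refl (begin-strict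
    2 * K                <⟨ m<m+n (2 * K) (s≤s z≤n) ⟩
    2 * K + 1            ≡⟨ cong₂ (λ a b → 2 * a + b) τ-gap-K (τ-parity-K-even p p≡0) ⟨
    code (τ (p , K))     ≤⟨ τ-in-range ⟩
    2 * K                ∎)
    where
      open ≤-Reasoning
      p≡0 : p ≡ 0
      p≡0 = n≤0⇒n≡0 (+-cancelˡ-≤ (2 * K) p 0 (≤-trans in-range (≤-reflexive (sym (+-identityʳ (2 * K))))))
      τ-parity-K-even : ∀ p → p ≡ 0 → τ-parity p K ≡ 1
      τ-parity-K-even p refl = trans (τ-parity≡ 0 K) (+-congˡ-% {2} 1 {K} {0} K-even)

  1≤#pairs : ∀ {f} → HalfParity K f → 1 ≤ #pairs f
  1≤#pairs hp = ≤-pred (≤-trans (*-monoʳ-≤ 2 (s≤s (z≤n {K′}))) (2K≤1+#pairs hp))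

  1≤code : ∀ p {d} → 0 < d → 1 ≤ code (p , d)
  1≤code p {d} 0<d = ≤-trans 0<d (≤-trans (m≤m+n d (d + 0)) (m≤m+n (2 * d) p))

  τ-enters-range : ∀ {f z} → HalfParity K f → IsNormal z → τ z ≢ z → ¬ InRange f z → InRange f (τ z)
  τ-enters-range {f} {zero , zero} hp _ _ _ =
    m≤n+m 1 (2 * τ-gap 0) , ≤-trans (≤-reflexive (cong (λ d → 2 * d + 1) τ-gap-zero)) (1≤#pairs hp)
  τ-enters-range {f} {suc zero , zero} hp _ _ out-of-range = ⊥-elim (out-of-range (s≤s z≤n , 1≤#pairs hp))
  τ-enters-range {z = suc (suc _) , zero} _ (s≤s (s≤s ()) , _)
  τ-enters-range {f} {p , suc d} hp (p<2 , d<m) non-fixed out-of-range with <-cmp (suc d) K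
  ... | tri< d<K _ _ = ⊥-elim (out-of-range (1≤code p (s≤s z≤n) , code<2K⇒≤#pairs (p , suc d) hp (code<2K p<2 d<K)))
  ... | tri> _ _ K<d = 1≤code (τ-parity p (suc d)) τ-gap>0 ,
                       code<2K⇒≤#pairs (τ (p , suc d)) hp (code<2K τ-parity<2 (τ-gap-flips-above K<d d<m))
    where
      τ-parity<2 : τ-parity p (suc d) < 2
      τ-parity<2 = proj₁ (τ-normal (one-even refl (inj₁ m-even)) (p<2 , d<m))
      τ-gap>0 : 0 < τ-gap (suc d)
      τ-gap>0 = subst (0 <_) (sym (τ-gap-pos (s≤s z≤n) d<m)) (m<n⇒0<n∸m d<m)
  ... | tri≈ _ refl _ with hp
  ...   | half-odd K-odd = ⊥-elim (non-fixed (τ-fixed⇐ K-odd p<2))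
  ...   | half-even K-even = by-parity p p<2 out-of-range
    where
      by-parity : ∀ p → p < 2 → ¬ InRange 0 (p , K) → InRange 0 (τ (p , K))
      by-parity zero _ out = ⊥-elim (out (1≤code 0 (s≤s z≤n) , ≤-reflexive (+-identityʳ (2 * K))))
      by-parity (suc zero) _ _ = 1≤code (τ-parity 1 K) (subst (0 <_) (sym τ-gap-K) (s≤s z≤n)) ,
        ≤-reflexive (trans (cong₂ (λ a b → 2 * a + b) τ-gap-K (trans (τ-parity≡ 1 K) (+-congˡ-% {2} 2 {K} {0} K-even)))
                           (+-identityʳ (2 * K)))
      by-parity (suc (suc _)) (s≤s (s≤s ()))

  pair : ∀ f → Fin (#pairs f) → ℕ × ℕ
  pair f t = decode (suc (toℕ t))

  code-pair : ∀ f t → code (pair f t) ≡ suc (toℕ t)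
  code-pair f t = code-decode (suc (toℕ t))

  pair-in-range : ∀ f t → InRange f (pair f t)
  pair-in-range f t = subst (1 ≤_) (sym (code-pair f t)) (s≤s z≤n) ,
                      subst (_≤ #pairs f) (sym (code-pair f t)) (toℕ<n t)

  pair-normal : ∀ f t → IsNormal (pair f t)
  pair-normal f t = m%n<n (suc (toℕ t)) 2 ,
                    <-≤-trans (m/n<m (suc (toℕ t)) 2 (s≤s (s≤s z≤n))) (≤-trans (toℕ<n t) (#pairs≤ f))

  pair-surjective : ∀ {f z} → IsNormal z → InRange f z → ∃ λ t → pair f t ≡ z
  pair-surjective {f} {z} (p<2 , _) (1≤code , code≤) = from-code (code z) refl 1≤code code≤
    where
      from-code : ∀ u → code z ≡ u → 1 ≤ u → u ≤ #pairs f → ∃ λ t → pair f t ≡ z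
      from-code (suc u) code≡ _ u<#pairs = fromℕ< u<#pairs , (begin
        decode (suc (toℕ (fromℕ< u<#pairs))) ≡⟨ cong (decode ∘ suc) (toℕ-fromℕ< u<#pairs) ⟩
        decode (suc u)                       ≡⟨ cong decode code≡ ⟨
        decode (code z)                      ≡⟨ decode-code p<2 ⟩
        z                                    ∎)
        where open ≡-Reasoning

  pair-non-fixed : ∀ {f} → HalfParity K f → ∀ t → τ (pair f t) ≢ pair f t
  pair-non-fixed {f} hp t fixed with τ-fixed⇒ (proj₁ (pair-normal f t)) (proj₂ (pair-normal f t)) fixed | hp
  ... | _ , K-odd | half-even K-even = 0≢1+n (trans (sym K-even) K-odd)
  ... | d≡K , _ | half-odd _ = <-irrefl refl (begin-strict
    2 * K                  ≡⟨ cong (2 *_) d≡K ⟨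
    2 * proj₂ (pair 1 t)   ≤⟨ m≤m+n _ (proj₁ (pair 1 t)) ⟩
    code (pair 1 t)        ≡⟨ code-pair 1 t ⟩
    suc (toℕ t)            ≤⟨ toℕ<n t ⟩
    2 * K ∸ 1              <⟨ ∸-monoʳ-< {2 * K} {1} {0} (s≤s z≤n) (s≤s z≤n) ⟩
    2 * K                  ∎)
    where open ≤-Reasoning

  pair-complete : ∀ {f} → HalfParity K f → ∀ z → IsNormal z → τ z ≢ z →
                  ∃ λ t → pair f t ≡ z ⊎ τ (pair f t) ≡ z
  pair-complete {f} hp z normal non-fixed with 1 ≤? code z ×-dec code z ≤? #pairs f
  ... | yes in-range = let (t , pair≡) = pair-surjective {f} normal in-range in t , inj₁ pair≡
  ... | no out-of-range =
    let (t , pair≡) = pair-surjective {f} (τ-normal (one-even refl (inj₁ m-even)) normal)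
                                      (τ-enters-range hp normal non-fixed out-of-range)
    in t , inj₂ (trans (cong τ pair≡) (τ-involutive normal))

  fixed : ∀ f → Fin (2 * f) → ℕ × ℕ
  fixed f t = toℕ t , K

  fixed-normal : ∀ {f} → HalfParity K f → ∀ t → IsNormal (fixed f t)
  fixed-normal (half-odd _) t = toℕ<n t , K<m
  fixed-normal (half-even _) ()

  fixed-τ : ∀ {f} → HalfParity K f → ∀ t → τ (fixed f t) ≡ fixed f t
  fixed-τ (half-odd K-odd) t = τ-fixed⇐ K-odd (toℕ<n t)
  fixed-τ (half-even _) ()

  fixed-complete : ∀ {f} → HalfParity K f → ∀ z → IsNormal z → τ z ≡ z → ∃ λ t → fixed f t ≡ z
  fixed-complete hp (p , d) (p<2 , d<m) τ-fixed with τ-fixed⇒ p<2 d<m τ-fixed | hp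
  ... | d≡K , _ | half-odd _ = fromℕ< p<2 , cong₂ _,_ (toℕ-fromℕ< p<2) (sym d≡K)
  ... | _ , K-odd | half-even K-even = ⊥-elim (0≢1+n (trans (sym K-even) K-odd))

  2*#pairs≡ : ∀ {f} → HalfParity K f → 2 * #pairs f ≡ (1 + 1) * (m + 1) ∸ 2 * (f + 1)
  2*#pairs≡ (half-odd _) = sym (cong (_∸ 4) (count K′))
    where count : ∀ K′ → (1 + 1) * (2 * suc K′ + 1) ≡ 4 + 2 * (K′ + suc (K′ + 0))
          count = solve-∀
  2*#pairs≡ (half-even _) = sym (cong (_∸ 2) (count K′))
    where count : ∀ K′ → (1 + 1) * (2 * suc K′ + 1) ≡ 2 + 2 * (2 * suc K′)
          count = solve-∀

  classification : ∀ {f} → HalfParity K f → Classification f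
  classification {f} hp = record
    { indicator = one-even refl (inj₁ m-even)
    ; #fixed = 2 * f
    ; fixed = fixed f
    ; fixed-normal = fixed-normal hp
    ; fixed-τ = fixed-τ hp
    ; fixed-injective = λ t t′ eq → toℕ-injective (cong proj₁ eq)
    ; fixed-complete = fixed-complete hp
    ; #pairs = #pairs f
    ; pair = pair f
    ; pair-normal = pair-normal f
    ; pair-τ = λ t t′ eq → τ-leaves-range hp (pair-normal f t) (pair-non-fixed hp t) (pair-in-range f t)
                                         (subst (InRange f) (sym eq) (pair-in-range f t′))
    ; pair-injective = λ t t′ eq →
        toℕ-injective (suc-injective (trans (sym (code-pair f t)) (trans (cong code eq) (code-pair f t′))))
    ; pair-complete = pair-complete hp
    ; #fixed≡ = refl
    ; 2*#pairs≡ = 2*#pairs≡ hp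
    }

open DiagonalInvolution using (Classification)

Classification-cong : ∀ {m′ m″ e e′ f f′} → m′ ≡ m″ → e ≡ e′ → f ≡ f′ →
                      Classification m′ e f → Classification m″ e′ f′
Classification-cong refl refl refl c = c

eN-mod4 : ∀ x → eN x ≡ eN (x % 4)
eN-mod4 x = cong (λ y → if y ≡ᵇ 0 then 1 else 0) (sym (m∣n⇒o%n%m≡o%m 2 4 x (divides 2 refl)))

fN-mod4 : ∀ x → fN x ≡ fN (x % 4)
fN-mod4 x = cong (λ y → if y ≡ᵇ 2 then 1 else 0) (sym (m%n%n≡m%n x 4))

-- abstract: unfolding the case split on m mod 4 makes type checking explode
abstract
  diagonalClassification : ∀ m′ → Classification m′ (eN (suc m′)) (fN (suc m′))
  diagonalClassification m′ = Classification-cong refl (sym (eN-mod4 (suc m′))) (sym (fN-mod4 (suc m′)))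
    (by-residue (suc m′ % 4) (suc m′ / 4) (m≡m%n+[m/n]*n (suc m′) 4) (m%n<n (suc m′) 4))
    where
      by-residue : ∀ r q → suc m′ ≡ r + q * 4 → r < 4 → Classification m′ (eN r) (fN r)
      by-residue 0 zero () _
      by-residue 0 (suc q) m≡ _ =
        Classification-cong (suc-injective (trans (expand q) (sym m≡))) refl refl
          (EvenDiagonal.classification (suc (2 * q))
            (half-even (trans (cong (_% 2) (expand′ q)) (m*n%n≡0 (suc q) 2))))
        where
          expand : ∀ q → 2 * suc (suc (2 * q)) ≡ suc q * 4
          expand = solve-∀
          expand′ : ∀ q → suc (suc (2 * q)) ≡ suc q * 2
          expand′ = solve-∀
      by-residue 1 q m≡ _ =
        Classification-cong (suc-injective (trans (expand q) (sym m≡))) refl refl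
          (OddDiagonal.classification (2 * q))
        where
          expand : ∀ q → suc (2 * (2 * q)) ≡ 1 + q * 4
          expand = solve-∀
      by-residue 2 q m≡ _ =
        Classification-cong (suc-injective (trans (expand q) (sym m≡))) refl refl
          (EvenDiagonal.classification (2 * q) (half-odd (trans (cong (_% 2) (expand′ q)) ([m+kn]%n≡m%n 1 q 2))))
        where
          expand : ∀ q → 2 * suc (2 * q) ≡ 2 + q * 4
          expand = solve-∀
          expand′ : ∀ q → suc (2 * q) ≡ 1 + q * 2
          expand′ = solve-∀
      by-residue 3 q m≡ _ =
        Classification-cong (suc-injective (trans (expand q) (sym m≡))) refl refl
          (OddDiagonal.classification (suc (2 * q)))
        where
          expand : ∀ q → suc (2 * suc (2 * q)) ≡ 3 + q * 4
          expand = solve-∀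
      by-residue (suc (suc (suc (suc _)))) _ _ (s≤s (s≤s (s≤s (s≤s ()))))

module OrbitCount {r : ℕ} (π : Permutation′ r) (s : ℕ) (ℓ : Fin s → ℕ)
                        (cycleType : HasCycleType π s (λ i → suc (ℓ i))) where

  L : Fin s → ℕ
  L i = suc (ℓ i)

  rep : Fin s → Fin r
  rep = proj₁ cycleType

  rep-separated : ∀ i j → SameCycle π (rep i) (rep j) → i ≡ j
  rep-separated = proj₁ (proj₂ cycleType)

  rep-covers : ∀ x → ∃ λ i → SameCycle π (rep i) x
  rep-covers = proj₁ (proj₂ (proj₂ cycleType))

  rep-length : ∀ i → IsCycleLength π (rep i) (L i)
  rep-length = proj₂ (proj₂ (proj₂ cycleType))

  move : ℕ → Fin r → Fin r
  move = iter (act π)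

  move-injective : ∀ u {x y} → move u x ≡ move u y → x ≡ y
  move-injective zero eq = eq
  move-injective (suc u) {x} {y} eq = move-injective u (begin
    move u x                         ≡⟨ inverseˡ π ⟨
    π ⟨$⟩ˡ (π ⟨$⟩ʳ move u x)         ≡⟨ cong (π ⟨$⟩ˡ_) eq ⟩
    π ⟨$⟩ˡ (π ⟨$⟩ʳ move u y)         ≡⟨ inverseˡ π ⟩
    move u y                         ∎)
    where open ≡-Reasoning

  move-period : ∀ i q → move (q * L i) (rep i) ≡ rep i
  move-period i = iter-periodic (act π) (L i) (rep i) (proj₁ (proj₂ (rep-length i)))

  move-% : ∀ i u → move u (rep i) ≡ move (u % L i) (rep i)
  move-% i u = begin
    move u (rep i)                                ≡⟨ cong (λ w → move w (rep i)) (m≡m%n+[m/n]*n u (L i)) ⟩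
    move (u % L i + u / L i * L i) (rep i)        ≡⟨ iter-+ (act π) (u % L i) _ (rep i) ⟩
    move (u % L i) (move (u / L i * L i) (rep i)) ≡⟨ cong (move (u % L i)) (move-period i (u / L i)) ⟩
    move (u % L i) (rep i)                        ∎
    where open ≡-Reasoning

  private
    no-early-return : ∀ i u v → u < v → v < L i → move u (rep i) ≢ move v (rep i)
    no-early-return i u v u<v v<L eq =
      proj₂ (proj₂ (rep-length i)) (v ∸ u) (m<n⇒0<n∸m u<v) (≤-<-trans (m∸n≤m v u) v<L)
        (sym (move-injective u (begin
        move u (rep i)                    ≡⟨ eq ⟩
        move v (rep i)                    ≡⟨ cong (λ w → move w (rep i)) (m∸n+n≡m (<⇒≤ u<v)) ⟨
        move (v ∸ u + u) (rep i)          ≡⟨ iter-+ (act π) (v ∸ u) u (rep i) ⟩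
        move (v ∸ u) (move u (rep i))     ≡⟨ iter-comm (act π) (v ∸ u) u (rep i) ⟩
        move u (move (v ∸ u) (rep i))     ∎)))
      where open ≡-Reasoning

    move-rep-injective : ∀ i {u v} → u < L i → v < L i → move u (rep i) ≡ move v (rep i) → u ≡ v
    move-rep-injective i {u} {v} u<L v<L eq with <-cmp u v
    ... | tri≈ _ u≡v _ = u≡v
    ... | tri< u<v _ _ = ⊥-elim (no-early-return i u v u<v v<L eq)
    ... | tri> _ _ v<u = ⊥-elim (no-early-return i v u v<u u<L (sym eq))

  move-rep≡⇒%≡ : ∀ i u v → move u (rep i) ≡ move v (rep i) → u % L i ≡ v % L i
  move-rep≡⇒%≡ i u v eq =
    move-rep-injective i (m%n<n u (L i)) (m%n<n v (L i)) (trans (sym (move-% i u)) (trans eq (move-% i v)))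

  %≡⇒move-rep≡ : ∀ i u v → u % L i ≡ v % L i → move u (rep i) ≡ move v (rep i)
  %≡⇒move-rep≡ i u v eq = trans (move-% i u) (trans (cong (λ w → move w (rep i)) eq) (sym (move-% i v)))

  cycle-unique : ∀ i j u v → move u (rep i) ≡ move v (rep j) → i ≡ j
  cycle-unique i j u v eq = rep-separated i j ((v * L j ∸ v) + u , (begin
    move (v * L j ∸ v + u) (rep i)        ≡⟨ iter-+ (act π) (v * L j ∸ v) u (rep i) ⟩
    move (v * L j ∸ v) (move u (rep i))   ≡⟨ cong (move (v * L j ∸ v)) eq ⟩
    move (v * L j ∸ v) (move v (rep j))   ≡⟨ iter-undo (act π) (L j) (rep j) (proj₁ (proj₂ (rep-length j))) (s≤s z≤n) v ⟩
    rep j                                 ∎))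
    where open ≡-Reasoning

  cycle : Fin r → Fin s
  cycle x = proj₁ (rep-covers x)

  position : Fin r → ℕ
  position x = proj₁ (proj₂ (rep-covers x))

  move-position : ∀ x → move (position x) (rep (cycle x)) ≡ x
  move-position x = proj₂ (proj₂ (rep-covers x))

  cycle-move-rep : ∀ {x i u} → move u (rep i) ≡ x → cycle x ≡ i
  cycle-move-rep {x} {i} {u} eq = cycle-unique (cycle x) i (position x) u (trans (move-position x) (sym eq))

  cycle-move : ∀ k x → cycle (move k x) ≡ cycle x
  cycle-move k x = cycle-move-rep {u = k + position x}
    (trans (iter-+ (act π) k (position x) _) (cong (move k) (move-position x)))

  move-period-point : ∀ x q → move (q * L (cycle x)) x ≡ x
  move-period-point x q = begin
    move (q * L (cycle x)) x                                    ≡⟨ cong (move (q * L (cycle x))) (move-position x) ⟨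
    move (q * L (cycle x)) (move (position x) (rep (cycle x)))  ≡⟨ iter-comm (act π) (q * L (cycle x)) (position x) _ ⟩
    move (position x) (move (q * L (cycle x)) (rep (cycle x)))  ≡⟨ cong (move (position x)) (move-period (cycle x) q) ⟩
    move (position x) (rep (cycle x))                           ≡⟨ move-position x ⟩
    x                                                           ∎
    where open ≡-Reasoning

  point : Fin s → Fin s → ℕ → ℕ → Pt π
  point i j u v = move u (rep i) , move v (rep j)

  point-coordinates : ∀ (a : Pt π) {i j} → cycle (proj₁ a) ≡ i → cycle (proj₂ a) ≡ j →
                      a ≡ point i j (position (proj₁ a)) (position (proj₂ a))
  point-coordinates (x , y) refl refl = sym (cong₂ _,_ (move-position x) (move-position y))

  cycle-point₁ : ∀ i j u v → cycle (proj₁ (point i j u v)) ≡ i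
  cycle-point₁ i j u v = cycle-move-rep {u = u} refl

  cycle-point₂ : ∀ i j u v → cycle (proj₂ (point i j u v)) ≡ j
  cycle-point₂ i j u v = cycle-move-rep {u = v} refl

  iter-sq : ∀ h (a : Pt π) → iter (sq π) h a ≡ (move (2 * h) (proj₁ a) , move (2 * h) (proj₂ a))
  iter-sq zero a = refl
  iter-sq (suc h) a = trans (cong (sq π) (iter-sq h a))
    (cong₂ _,_ (cong (λ w → move w (proj₁ a)) (sym (two-suc h))) (cong (λ w → move w (proj₂ a)) (sym (two-suc h))))
    where two-suc : ∀ h → 2 * suc h ≡ suc (suc (2 * h))
          two-suc = solve-∀

  SameOrbit⇒EvenShifted : ∀ i j u v u′ v′ → SameOrbit π (point i j u v) (point i j u′ v′) →
                          EvenShifted (L i) (L j) u v u′ v′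
  SameOrbit⇒EvenShifted i j u v u′ v′ (h , eq) = h ,
      move-rep≡⇒%≡ i (2 * h + u) u′ (trans (iter-+ (act π) (2 * h) u (rep i)) (cong proj₁ eq′)) ,
      move-rep≡⇒%≡ j (2 * h + v) v′ (trans (iter-+ (act π) (2 * h) v (rep j)) (cong proj₂ eq′))
    where eq′ = trans (sym (iter-sq h (point i j u v))) eq

  EvenShifted⇒SameOrbit : ∀ i j u v u′ v′ → EvenShifted (L i) (L j) u v u′ v′ →
                          SameOrbit π (point i j u v) (point i j u′ v′)
  EvenShifted⇒SameOrbit i j u v u′ v′ (h , ≡u′ , ≡v′) = h , trans (iter-sq h (point i j u v))
    (cong₂ _,_ (trans (sym (iter-+ (act π) (2 * h) u (rep i))) (%≡⇒move-rep≡ i (2 * h + u) u′ ≡u′))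
               (trans (sym (iter-+ (act π) (2 * h) v (rep j))) (%≡⇒move-rep≡ j (2 * h + v) v′ ≡v′)))

  SameOrbit-cycles : ∀ {a b : Pt π} → SameOrbit π a b →
                     cycle (proj₁ a) ≡ cycle (proj₁ b) × cycle (proj₂ a) ≡ cycle (proj₂ b)
  SameOrbit-cycles {x , y} (h , eq) =
    trans (sym (cycle-move (2 * h) x)) (cong (cycle ∘ proj₁) eq′) ,
    trans (sym (cycle-move (2 * h) y)) (cong (cycle ∘ proj₂) eq′)
    where eq′ = trans (sym (iter-sq h (x , y))) eq

  SameOrbit-refl : ∀ a → SameOrbit π a a
  SameOrbit-refl a = 0 , refl

  SameOrbit-trans : ∀ {a b c} → SameOrbit π a b → SameOrbit π b c → SameOrbit π a c
  SameOrbit-trans {a} (k , a→b) (l , b→c) =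
    l + k , trans (iter-+ (sq π) l k a) (trans (cong (iter (sq π) l) a→b) b→c)

  -- π² has order dividing L i · L j on the pair of cycles through a
  SameOrbit-sym : ∀ {a b} → SameOrbit π a b → SameOrbit π b a
  SameOrbit-sym {x , y} {b} (k , eq) =
    k * P ∸ k ,
    subst (λ w → iter (sq π) (k * P ∸ k) w ≡ (x , y)) eq (iter-undo (sq π) P (x , y) period (s≤s z≤n) k)
    where
      P = L (cycle x) * L (cycle y)
      period : iter (sq π) P (x , y) ≡ (x , y)
      period = trans (iter-sq P (x , y)) (cong₂ _,_
        (trans (cong (λ w → move w x) (swap (L (cycle x)) (L (cycle y)))) (move-period-point x (2 * L (cycle y))))
        (trans (cong (λ w → move w y) (assoc (L (cycle x)) (L (cycle y)))) (move-period-point y (2 * L (cycle x)))))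
        where
          swap : ∀ a b → 2 * (a * b) ≡ (2 * b) * a
          swap = solve-∀
          assoc : ∀ a b → 2 * (a * b) ≡ (2 * a) * b
          assoc = solve-∀

  σ-iter-sq : ∀ k (a : Pt π) → σ π (iter (sq π) k a) ≡ iter (sq π) k (σ π a)
  σ-iter-sq zero a = refl
  σ-iter-sq (suc k) a = cong (sq π) (σ-iter-sq k a)

  SameOrbit-σ : ∀ {a b} → SameOrbit π a b → SameOrbit π (σ π a) (σ π b)
  SameOrbit-σ {a} (k , eq) = k , trans (sym (σ-iter-sq k a)) (cong (σ π) eq)

  SameOrbit-σσ : ∀ a → SameOrbit π a (σ π (σ π a))
  SameOrbit-σσ a = 1 , refl

  SamePair-refl : ∀ a → SamePair π a a
  SamePair-refl a = inj₁ (SameOrbit-refl a)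

  SamePair-sym : ∀ {a b} → SamePair π a b → SamePair π b a
  SamePair-sym (inj₁ a~b) = inj₁ (SameOrbit-sym a~b)
  SamePair-sym {a} {b} (inj₂ σa~b) =
    inj₂ (SameOrbit-trans (SameOrbit-sym (SameOrbit-σ σa~b)) (SameOrbit-sym (SameOrbit-σσ a)))

  SamePair-trans : ∀ {a b c} → SamePair π a b → SamePair π b c → SamePair π a c
  SamePair-trans (inj₁ a~b) (inj₁ b~c) = inj₁ (SameOrbit-trans a~b b~c)
  SamePair-trans (inj₁ a~b) (inj₂ σb~c) = inj₂ (SameOrbit-trans (SameOrbit-σ a~b) σb~c)
  SamePair-trans (inj₂ σa~b) (inj₁ b~c) = inj₂ (SameOrbit-trans σa~b b~c)
  SamePair-trans {a} (inj₂ σa~b) (inj₂ σb~c) =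
    inj₁ (SameOrbit-trans (SameOrbit-σσ a) (SameOrbit-trans (SameOrbit-σ σa~b) σb~c))

  FixedOrbit-resp : ∀ {a b} → SameOrbit π a b → FixedOrbit π a → FixedOrbit π b
  FixedOrbit-resp a~b fixed = SameOrbit-trans (SameOrbit-sym a~b) (SameOrbit-trans fixed (SameOrbit-σ a~b))

  FixedOrbit-σ⁻ : ∀ {a} → FixedOrbit π (σ π a) → FixedOrbit π a
  FixedOrbit-σ⁻ {a} fixed = SameOrbit-trans (SameOrbit-σσ a) (SameOrbit-sym fixed)

  NonFixedOrbit-resp : ∀ {a b} → SamePair π a b → NonFixedOrbit π a → NonFixedOrbit π b
  NonFixedOrbit-resp (inj₁ a~b) non-fixed fixed = non-fixed (FixedOrbit-resp (SameOrbit-sym a~b) fixed)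
  NonFixedOrbit-resp (inj₂ σa~b) non-fixed fixed =
    non-fixed (FixedOrbit-σ⁻ (FixedOrbit-resp (SameOrbit-sym σa~b) fixed))

  InBlock : Fin s → Fin s → Pt π → Set
  InBlock i j a = cycle (proj₁ a) ≡ i × cycle (proj₂ a) ≡ j

  UnorderedBlock : Fin s → Fin s → Pt π → Set
  UnorderedBlock i j a = InBlock i j a ⊎ InBlock j i a

  InBlock-point : ∀ i j u v → InBlock i j (point i j u v)
  InBlock-point i j u v = cycle-point₁ i j u v , cycle-point₂ i j u v

  SameOrbit-InBlock : ∀ {i j a b} → SameOrbit π a b → InBlock i j a → InBlock i j b
  SameOrbit-InBlock a~b (refl , refl) = let (c₁ , c₂) = SameOrbit-cycles a~b in sym c₁ , sym c₂

  σ-InBlock : ∀ {i j} a → InBlock i j a → InBlock j i (σ π a)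
  σ-InBlock (x , y) (refl , refl) = cycle-move 1 y , cycle-move 1 x

  SamePair-UnorderedBlock : ∀ {i j a b} → SamePair π a b → UnorderedBlock i j a → UnorderedBlock i j b
  SamePair-UnorderedBlock (inj₁ a~b) (inj₁ block) = inj₁ (SameOrbit-InBlock a~b block)
  SamePair-UnorderedBlock (inj₁ a~b) (inj₂ block) = inj₂ (SameOrbit-InBlock a~b block)
  SamePair-UnorderedBlock {a = a} (inj₂ σa~b) (inj₁ block) = inj₂ (SameOrbit-InBlock σa~b (σ-InBlock a block))
  SamePair-UnorderedBlock {a = a} (inj₂ σa~b) (inj₂ block) = inj₁ (SameOrbit-InBlock σa~b (σ-InBlock a block))

  SamePair-InBlock : ∀ {i a b} → SamePair π a b → InBlock i i a → InBlock i i b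
  SamePair-InBlock a≈b block with SamePair-UnorderedBlock a≈b (inj₁ block)
  ... | inj₁ block′ = block′
  ... | inj₂ block′ = block′

  FixedOrbit⇒InBlock : ∀ a → FixedOrbit π a → InBlock (cycle (proj₁ a)) (cycle (proj₁ a)) a
  FixedOrbit⇒InBlock (x , y) fixed = refl , sym (trans (proj₁ (SameOrbit-cycles fixed)) (cycle-move 1 y))

  σ-preimage : ∀ (a : Pt π) → ∃ λ w → σ π w ≡ a × InBlock (cycle (proj₂ a)) (cycle (proj₁ a)) w
  σ-preimage (x , y) = (move Q y , move Q x) , cong₂ _,_ x-back y-back , cycle-move Q y , cycle-move Q x
    where
      Q = ℓ (cycle x) + ℓ (cycle y) * L (cycle x)
      x-back : move (suc Q) x ≡ x
      x-back = move-period-point x (L (cycle y))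
      y-back : move (suc Q) y ≡ y
      y-back = trans (cong (λ w → move w y) (*-comm (L (cycle y)) (L (cycle x)))) (move-period-point y (L (cycle x)))

  module DiagonalBlock (i : Fin s) where

    open DiagonalInvolution (ℓ i) (eN (L i)) hiding (Classification)
    open Classification (diagonalClassification (ℓ i))
    open EvenShift (ℓ i) (ℓ i) (ℓ i) using (normalForm; normalForm-unique)

    diagPoint : ℕ × ℕ → Pt π
    diagPoint (p , d) = point i i p (p + d)

    τ-diagPoint : ∀ z → IsNormal z → SameOrbit π (diagPoint (τ z)) (σ π (diagPoint z))
    τ-diagPoint (p , d) normal =
      EvenShifted⇒SameOrbit i i _ _ (suc (p + d)) (suc p) (τ-normalises-swap indicator normal)

    diagPoint-injective : ∀ z z′ → IsNormal z → IsNormal z′ →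
                          SameOrbit π (diagPoint z) (diagPoint z′) → z ≡ z′
    diagPoint-injective (p , d) (p′ , d′) (p< , d<) (p′< , d′<) z~z′ =
      let (p≡ , d≡) = normalForm-unique GCD.refl indicator p< p′< d< d′<
                        (SameOrbit⇒EvenShifted i i p (p + d) p′ (p′ + d′) z~z′)
      in cong₂ _,_ p≡ d≡

    diagPoint-covers : ∀ a → InBlock i i a → ∃ λ z → IsNormal z × SameOrbit π (diagPoint z) a
    diagPoint-covers a block with normalForm GCD.refl indicator (position (proj₁ a)) (position (proj₂ a))
    ... | p , d , p< , d< , shifted =
      (p , d) , (p< , d<) , subst (SameOrbit π (diagPoint (p , d))) (sym (point-coordinates a (proj₁ block) (proj₂ block)))
                                  (EvenShifted⇒SameOrbit i i p (p + d) (position (proj₁ a)) (position (proj₂ a)) shifted)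

    InBlock-diagPoint : ∀ z → InBlock i i (diagPoint z)
    InBlock-diagPoint (p , d) = InBlock-point i i p (p + d)

    FixedOrbit⇒τ-fixed : ∀ z → IsNormal z → FixedOrbit π (diagPoint z) → τ z ≡ z
    FixedOrbit⇒τ-fixed z normal fixed =
      sym (diagPoint-injective z (τ z) normal (τ-normal indicator {z} normal)
             (SameOrbit-trans fixed (SameOrbit-sym (τ-diagPoint z normal))))

    τ-fixed⇒FixedOrbit : ∀ z → IsNormal z → τ z ≡ z → FixedOrbit π (diagPoint z)
    τ-fixed⇒FixedOrbit z normal τz≡z =
      subst (λ w → SameOrbit π (diagPoint w) (σ π (diagPoint z))) τz≡z (τ-diagPoint z normal)

    fixedClasses : NumClasses (SameOrbit π) (λ a → FixedOrbit π a × InBlock i i a) #fixed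
    fixedClasses = NumClasses-⇔ (SameOrbit π) to from
      (NumClasses-reps (SameOrbit π) #fixed (diagPoint ∘ fixed) distinct SameOrbit-refl)
      where
        distinct : ∀ t t′ → SameOrbit π (diagPoint (fixed t)) (diagPoint (fixed t′)) → t ≡ t′
        distinct t t′ t~t′ =
          fixed-injective t t′ (diagPoint-injective (fixed t) (fixed t′) (fixed-normal t) (fixed-normal t′) t~t′)
        to : ∀ a → (∃ λ t → SameOrbit π (diagPoint (fixed t)) a) → FixedOrbit π a × InBlock i i a
        to a (t , t~a) = FixedOrbit-resp t~a (τ-fixed⇒FixedOrbit (fixed t) (fixed-normal t) (fixed-τ t)) ,
                         SameOrbit-InBlock t~a (InBlock-diagPoint (fixed t))
        from : ∀ a → FixedOrbit π a × InBlock i i a → ∃ λ t → SameOrbit π (diagPoint (fixed t)) a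
        from a (a-fixed , block) =
          let (z , normal , z~a) = diagPoint-covers a block
              z-fixed = FixedOrbit⇒τ-fixed z normal (FixedOrbit-resp (SameOrbit-sym z~a) a-fixed)
              (t , t≡z) = fixed-complete z normal z-fixed
          in t , subst (λ w → SameOrbit π (diagPoint w) a) (sym t≡z) z~a

    pairClasses : NumClasses (SamePair π) (λ a → NonFixedOrbit π a × InBlock i i a) #pairs
    pairClasses = NumClasses-⇔ (SamePair π) to from
      (NumClasses-reps (SamePair π) #pairs (diagPoint ∘ pair) distinct SamePair-refl)
      where
        distinct : ∀ t t′ → SamePair π (diagPoint (pair t)) (diagPoint (pair t′)) → t ≡ t′
        distinct t t′ (inj₁ t~t′) =
          pair-injective t t′ (diagPoint-injective (pair t) (pair t′) (pair-normal t) (pair-normal t′) t~t′)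
        distinct t t′ (inj₂ σt~t′) = ⊥-elim (pair-τ t t′
          (diagPoint-injective (τ (pair t)) (pair t′) (τ-normal indicator {pair t} (pair-normal t)) (pair-normal t′)
            (SameOrbit-trans (τ-diagPoint (pair t) (pair-normal t)) σt~t′)))
        non-fixed : ∀ t → NonFixedOrbit π (diagPoint (pair t))
        non-fixed t fixed = pair-τ t t (FixedOrbit⇒τ-fixed (pair t) (pair-normal t) fixed)
        to : ∀ a → (∃ λ t → SamePair π (diagPoint (pair t)) a) → NonFixedOrbit π a × InBlock i i a
        to a (t , t≈a) = NonFixedOrbit-resp t≈a (non-fixed t) , SamePair-InBlock t≈a (InBlock-diagPoint (pair t))
        represent : ∀ {a} z → SameOrbit π (diagPoint z) a → (∃ λ t → pair t ≡ z ⊎ τ (pair t) ≡ z) →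
                    ∃ λ t → SamePair π (diagPoint (pair t)) a
        represent z z~a (t , inj₁ refl) = t , inj₁ z~a
        represent z z~a (t , inj₂ refl) =
          t , inj₂ (SameOrbit-trans (SameOrbit-sym (τ-diagPoint (pair t) (pair-normal t))) z~a)
        from : ∀ a → NonFixedOrbit π a × InBlock i i a → ∃ λ t → SamePair π (diagPoint (pair t)) a
        from a (a-non-fixed , block) =
          let (z , normal , z~a) = diagPoint-covers a block
              z-non-fixed = λ τz≡z → a-non-fixed (FixedOrbit-resp z~a (τ-fixed⇒FixedOrbit z normal τz≡z))
          in represent z z~a (pair-complete z normal z-non-fixed)

  gcd-suc : ∀ m′ n′ → ∃ λ g′ → gcd (suc m′) (suc n′) ≡ suc g′
  gcd-suc m′ n′ with gcd (suc m′) (suc n′) | gcd[m,n]≢0 (suc m′) (suc n′) (inj₁ (λ ()))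
  ... | zero | gcd≢0 = ⊥-elim (gcd≢0 refl)
  ... | suc g′ | _ = g′ , refl

  [d+pg]/g≡p : ∀ d p g .{{_ : NonZero g}} → d < g → (d + p * g) / g ≡ p
  [d+pg]/g≡p d p g d<g = begin
    (d + p * g) / g    ≡⟨ +-distrib-/-∣ʳ d (n∣m*n p) ⟩
    d / g + p * g / g  ≡⟨ cong₂ _+_ (m<n⇒m/n≡0 d<g) (m*n/n≡m p g) ⟩
    p                  ∎
    where open ≡-Reasoning

  [d+pg]%g≡d : ∀ d p g .{{_ : NonZero g}} → d < g → (d + p * g) % g ≡ d
  [d+pg]%g≡d d p g d<g = trans ([m+kn]%n≡m%n d p g) (m<n⇒m%n≡m d<g)

  module OffDiagonalBlock (i j : Fin s) (i<j : toℕ i < toℕ j) where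

    e : ℕ
    e = eN2 (L i) (L j)

    g′ g : ℕ
    g′ = proj₁ (gcd-suc (ℓ i) (ℓ j))
    g = suc g′

    isGCD : GCD (L i) (L j) g
    isGCD = subst (GCD (L i) (L j)) (proj₂ (gcd-suc (ℓ i) (ℓ j))) (gcd-GCD (L i) (L j))

    open EvenShift (ℓ i) (ℓ j) g′ using (normalForm; normalForm-unique)

    #reps : ℕ
    #reps = (1 + e) * g

    -- t codes the normal form (t / g , t % g)
    offPoint : Fin #reps → Pt π
    offPoint t = point i j (toℕ t / g) (toℕ t / g + toℕ t % g)

    i≢j : i ≢ j
    i≢j i≡j = <-irrefl (cong toℕ i≡j) i<j

    not-InBlock-σ : ∀ {a b} → InBlock i j a → ¬ (SameOrbit π (σ π a) b × InBlock i j b)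
    not-InBlock-σ {a} block (σa~b , block′) =
      i≢j (trans (sym (proj₁ block′)) (proj₁ (SameOrbit-InBlock σa~b (σ-InBlock a block))))

    InBlock-offPoint : ∀ t → InBlock i j (offPoint t)
    InBlock-offPoint t = InBlock-point i j (toℕ t / g) (toℕ t / g + toℕ t % g)

    offPoint-covers : ∀ a → InBlock i j a → ∃ λ t → SameOrbit π (offPoint t) a
    offPoint-covers a block =
      let (p , d , p< , d< , shifted) =
            normalForm isGCD (parityIndicator (L i) (L j)) (position (proj₁ a)) (position (proj₂ a))
          code< : d + p * g < #reps
          code< = <-≤-trans (+-monoˡ-< (p * g) d<) (*-monoˡ-≤ g p<)
          offPoint≡ : offPoint (fromℕ< code<) ≡ point i j p (p + d)
          offPoint≡ = trans (cong (λ c → point i j (c / g) (c / g + c % g)) (toℕ-fromℕ< code<))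
                            (cong₂ (λ x y → point i j x (x + y)) ([d+pg]/g≡p d p g d<) ([d+pg]%g≡d d p g d<))
      in fromℕ< code< , subst₂ (SameOrbit π) (sym offPoint≡) (sym (point-coordinates a (proj₁ block) (proj₂ block)))
                          (EvenShifted⇒SameOrbit i j p (p + d) (position (proj₁ a)) (position (proj₂ a)) shifted)

    offPoint-injective : ∀ t t′ → SameOrbit π (offPoint t) (offPoint t′) → t ≡ t′
    offPoint-injective t t′ t~t′ = toℕ-injective (begin
      toℕ t                          ≡⟨ m≡m%n+[m/n]*n (toℕ t) g ⟩
      toℕ t % g + toℕ t / g * g      ≡⟨ cong₂ (λ x y → x + y * g) (proj₂ same) (proj₁ same) ⟩
      toℕ t′ % g + toℕ t′ / g * g    ≡⟨ m≡m%n+[m/n]*n (toℕ t′) g ⟨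
      toℕ t′                         ∎)
      where
        open ≡-Reasoning
        same = normalForm-unique isGCD (parityIndicator (L i) (L j))
                 (m<n*o⇒m/o<n (toℕ<n t)) (m<n*o⇒m/o<n (toℕ<n t′)) (m%n<n (toℕ t) g) (m%n<n (toℕ t′) g)
                 (SameOrbit⇒EvenShifted i j _ _ (toℕ t′ / g) (toℕ t′ / g + toℕ t′ % g) t~t′)

    classes : NumClasses (SamePair π) (λ a → NonFixedOrbit π a × UnorderedBlock i j a) #reps
    classes = NumClasses-⇔ (SamePair π) to from
      (NumClasses-reps (SamePair π) #reps offPoint distinct SamePair-refl)
      where
        distinct : ∀ t t′ → SamePair π (offPoint t) (offPoint t′) → t ≡ t′
        distinct t t′ (inj₁ t~t′) = offPoint-injective t t′ t~t′
        distinct t t′ (inj₂ σt~t′) = ⊥-elim (not-InBlock-σ (InBlock-offPoint t) (σt~t′ , InBlock-offPoint t′))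
        non-fixed : ∀ t → NonFixedOrbit π (offPoint t)
        non-fixed t fixed = not-InBlock-σ (InBlock-offPoint t) (SameOrbit-sym fixed , InBlock-offPoint t)
        to : ∀ a → (∃ λ t → SamePair π (offPoint t) a) → NonFixedOrbit π a × UnorderedBlock i j a
        to a (t , t≈a) = NonFixedOrbit-resp t≈a (non-fixed t) , SamePair-UnorderedBlock t≈a (inj₁ (InBlock-offPoint t))
        from : ∀ a → NonFixedOrbit π a × UnorderedBlock i j a → ∃ λ t → SamePair π (offPoint t) a
        from a (_ , inj₁ block) = let (t , t~a) = offPoint-covers a block in t , inj₁ t~a
        from a (_ , inj₂ (refl , refl)) =
          let (w , σw≡a , block) = σ-preimage a
              (t , t~w) = offPoint-covers w block
          in t , inj₂ (subst (SameOrbit π (σ π (offPoint t))) σw≡a (SameOrbit-σ t~w))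

  UnorderedBlock-unique : ∀ {i j i′ j′ a} → toℕ i < toℕ j → toℕ i′ < toℕ j′ →
                          UnorderedBlock i j a → UnorderedBlock i′ j′ a → i ≡ i′ × j ≡ j′
  UnorderedBlock-unique _ _ (inj₁ (refl , refl)) (inj₁ (refl , refl)) = refl , refl
  UnorderedBlock-unique i<j i′<j′ (inj₁ (refl , refl)) (inj₂ (refl , refl)) = ⊥-elim (<-asym i<j i′<j′)
  UnorderedBlock-unique i<j i′<j′ (inj₂ (refl , refl)) (inj₁ (refl , refl)) = ⊥-elim (<-asym i<j i′<j′)
  UnorderedBlock-unique _ _ (inj₂ (refl , refl)) (inj₂ (refl , refl)) = refl , refl

  InBlock-diagonal : ∀ {i i′ j′ a} → toℕ i′ < toℕ j′ → InBlock i i a → ¬ UnorderedBlock i′ j′ a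
  InBlock-diagonal i′<j′ (refl , y-i) (inj₁ (refl , refl)) = <-irrefl (cong toℕ (sym y-i)) i′<j′
  InBlock-diagonal i′<j′ (refl , y-i) (inj₂ (refl , refl)) = <-irrefl (cong toℕ y-i) i′<j′

  #fixed #pairs : Fin s → ℕ
  #fixed i = Classification.#fixed (diagonalClassification (ℓ i))
  #pairs i = Classification.#pairs (diagonalClassification (ℓ i))

  offDiagonalSize : Fin s → Fin s → ℕ
  offDiagonalSize i j = if toℕ i <ᵇ toℕ j then (1 + eN2 (L i) (L j)) * gcd (L i) (L j) else 0

  fixedCount : NumClasses (SameOrbit π) (FixedOrbit π) (sumFin s #fixed)
  fixedCount = NumClasses-⇔ (SameOrbit π) (λ a (_ , fixed , _) → fixed) (λ a fixed → _ , fixed , FixedOrbit⇒InBlock a fixed)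
    (NumClasses-Σ (SameOrbit π) s (λ i a → FixedOrbit π a × InBlock i i a) #fixed DiagonalBlock.fixedClasses
      (λ i j a b (_ , a-i , _) (_ , b-j , _) a~b → trans (sym a-i) (trans (proj₁ (SameOrbit-cycles a~b)) b-j)))

  <ᵇ-< : ∀ {i j : Fin s} → T (toℕ i <ᵇ toℕ j) → toℕ i < toℕ j
  <ᵇ-< {i} {j} = <ᵇ⇒< (toℕ i) (toℕ j)

  OffDiagonal : Fin s → Fin s → Pt π → Set
  OffDiagonal i j a = T (toℕ i <ᵇ toℕ j) × NonFixedOrbit π a × UnorderedBlock i j a

  offDiagonalClasses : ∀ i j → NumClasses (SamePair π) (OffDiagonal i j) (offDiagonalSize i j)
  offDiagonalClasses i j with toℕ i <ᵇ toℕ j in i<ᵇj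
  ... | false = NumClasses-∅ (SamePair π) (λ a → proj₁)
  ... | true = subst (NumClasses (SamePair π) _) (cong ((1 + eN2 (L i) (L j)) *_) (sym (proj₂ (gcd-suc (ℓ i) (ℓ j)))))
    (NumClasses-⇔ (SamePair π) (λ a → tt ,_) (λ a → proj₂)
      (OffDiagonalBlock.classes i j (<ᵇ-< {i} {j} (subst T (sym i<ᵇj) tt))))

  NonFixedDiagonal NonFixedOffDiagonal : Pt π → Set
  NonFixedDiagonal a = ∃ λ i → NonFixedOrbit π a × InBlock i i a
  NonFixedOffDiagonal a = ∃ λ i → ∃ λ j → OffDiagonal i j a

  nonFixedDiagonalCount : NumClasses (SamePair π) NonFixedDiagonal (sumFin s #pairs)
  nonFixedDiagonalCount =
    NumClasses-Σ (SamePair π) s (λ i a → NonFixedOrbit π a × InBlock i i a) #pairs DiagonalBlock.pairClasses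
      (λ i j a b (_ , ia) (_ , jb) a≈b → trans (sym (proj₁ (SamePair-InBlock a≈b ia))) (proj₁ jb))

  nonFixedOffDiagonalCount : NumClasses (SamePair π) NonFixedOffDiagonal (sumFin s (λ i → sumFin s (offDiagonalSize i)))
  nonFixedOffDiagonalCount = NumClasses-Σ (SamePair π) s (λ i a → ∃ λ j → OffDiagonal i j a) _
    (λ i → NumClasses-Σ (SamePair π) s (OffDiagonal i) _ (offDiagonalClasses i)
      (λ j j′ a b (i<j , _ , ua) (i<j′ , _ , ub) a≈b →
        proj₂ (UnorderedBlock-unique (<ᵇ-< i<j) (<ᵇ-< i<j′) (SamePair-UnorderedBlock a≈b ua) ub)))
    (λ i i′ a b (j , i<j , _ , ua) (j′ , i′<j′ , _ , ub) a≈b →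
      proj₁ (UnorderedBlock-unique (<ᵇ-< i<j) (<ᵇ-< i′<j′) (SamePair-UnorderedBlock a≈b ua) ub))

  nonFixedCount : NumClasses (SamePair π) (NonFixedOrbit π) (sumFin s #pairs + sumFin s (λ i → sumFin s (offDiagonalSize i)))
  nonFixedCount = NumClasses-⇔ (SamePair π) to from
    (NumClasses-⊎ (SamePair π) nonFixedDiagonalCount nonFixedOffDiagonalCount
      separated (λ a b da ob b≈a → separated a b da ob (SamePair-sym b≈a)))
    where
      separated : ∀ a b → NonFixedDiagonal a → NonFixedOffDiagonal b → ¬ SamePair π a b
      separated a b (_ , _ , ia) (_ , _ , i<j , _ , ub) a≈b = InBlock-diagonal (<ᵇ-< i<j) (SamePair-InBlock a≈b ia) ub
      to : ∀ a → NonFixedDiagonal a ⊎ NonFixedOffDiagonal a → NonFixedOrbit π a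
      to a (inj₁ (_ , non-fixed , _)) = non-fixed
      to a (inj₂ (_ , _ , _ , non-fixed , _)) = non-fixed
      from : ∀ a → NonFixedOrbit π a → NonFixedDiagonal a ⊎ NonFixedOffDiagonal a
      from (x , y) non-fixed with <-cmp (toℕ (cycle x)) (toℕ (cycle y))
      ... | tri≈ _ eq _ = inj₁ (cycle x , non-fixed , refl , sym (toℕ-injective eq))
      ... | tri< lt _ _ = inj₂ (cycle x , cycle y , <⇒<ᵇ lt , non-fixed , inj₁ (refl , refl))
      ... | tri> _ _ gt = inj₂ (cycle y , cycle x , <⇒<ᵇ gt , non-fixed , inj₂ (refl , refl))

  fixedOrbitCount : NumClasses (SameOrbit π) (FixedOrbit π) (eta s L)
  fixedOrbitCount = subst (NumClasses (SameOrbit π) (FixedOrbit π))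
    (sumFin-cong s (λ i → Classification.#fixed≡ (diagonalClassification (ℓ i)))) fixedCount

  orbitPairCount : NumClasses (SamePair π) (NonFixedOrbit π) (zeta s L)
  orbitPairCount = subst (NumClasses (SamePair π) (NonFixedOrbit π))
    (cong (_+ sumFin s (λ i → sumFin s (offDiagonalSize i))) sumFin-#pairs≡) nonFixedCount
    where
      sumFin-#pairs≡ : sumFin s #pairs ≡ sumFin s (λ i → (1 + eN (L i)) * (L i + 1) ∸ 2 * (fN (L i) + 1)) / 2
      sumFin-#pairs≡ = sym (begin
        sumFin s (λ i → (1 + eN (L i)) * (L i + 1) ∸ 2 * (fN (L i) + 1)) / 2
          ≡⟨ cong (_/ 2) (sumFin-cong s (λ i → sym (Classification.2*#pairs≡ (diagonalClassification (ℓ i))))) ⟩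
        sumFin s (λ i → 2 * #pairs i) / 2   ≡⟨ cong (_/ 2) (sumFin-distribˡ-* 2 s #pairs) ⟩
        2 * sumFin s #pairs / 2             ≡⟨ cong (_/ 2) (*-comm 2 (sumFin s #pairs)) ⟩
        sumFin s #pairs * 2 / 2             ≡⟨ m*n/n≡m (sumFin s #pairs) 2 ⟩
        sumFin s #pairs                     ∎)
        where open ≡-Reasoning

module _ {r : ℕ} (π : Permutation′ r) {s : ℕ} where

  HasCycleType-cong : ∀ {lam lam′ : Fin s → ℕ} → (∀ i → lam i ≡ lam′ i) →
                      HasCycleType π s lam → HasCycleType π s lam′
  HasCycleType-cong lam≡ (rep , separated , covers , lengths) =
    rep , separated , covers , λ i → subst (IsCycleLength π (rep i)) (lam≡ i) (lengths i)

  cycle-length-suc : ∀ {lam : Fin s → ℕ} → HasCycleType π s lam → ∀ i → suc (pred (lam i)) ≡ lam i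
  cycle-length-suc (_ , _ , _ , lengths) i = suc-pred (_) {{>-nonZero (proj₁ (lengths i))}}

eta-cong : ∀ s {lam lam′ : Fin s → ℕ} → (∀ i → lam i ≡ lam′ i) → eta s lam ≡ eta s lam′
eta-cong s lam≡ = sumFin-cong s (λ i → cong (λ x → (1 ∸ eN x) + 2 * fN x) (lam≡ i))

zeta-cong : ∀ s {lam lam′ : Fin s → ℕ} → (∀ i → lam i ≡ lam′ i) → zeta s lam ≡ zeta s lam′
zeta-cong s lam≡ = cong₂ _+_
  (cong (_/ 2) (sumFin-cong s (λ i → cong (λ x → (1 + eN x) * (x + 1) ∸ 2 * (fN x + 1)) (lam≡ i))))
  (sumFin-cong s (λ i → sumFin-cong s (λ j →
    cong₂ (λ x y → if toℕ i <ᵇ toℕ j then (1 + eN2 x y) * gcd x y else 0) (lam≡ i) (lam≡ j))))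

theorem8p4 : (r : ℕ) (π : Permutation′ r) (s : ℕ) (lam : Fin s → ℕ) →
    HasCycleType π s lam →
    NumClasses (SameOrbit π) (FixedOrbit π) (eta s lam)
      × NumClasses (SamePair π) (NonFixedOrbit π) (zeta s lam)
theorem8p4 r π s lam cycleType =
  subst (NumClasses (SameOrbit π) (FixedOrbit π)) (eta-cong s lam≡) fixedOrbitCount ,
  subst (NumClasses (SamePair π) (NonFixedOrbit π)) (zeta-cong s lam≡) orbitPairCount
  where
    lam≡ : ∀ i → suc (pred (lam i)) ≡ lam i
    lam≡ = cycle-length-suc π cycleType
    open OrbitCount π s (pred ∘ lam) (HasCycleType-cong π (sym ∘ lam≡) cycleType)
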